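{- Let $H$ be a graph with vertex set $\{v_1,\dots,v_{n(H)}\}$, let $\mathcal{X}=\{X_i:1\le i\le n(H)\}$ be a family of graphs, each with at least one vertex, let $G=H\circ\mathcal{X}$, and let $F=\{v_i\in V(H):\mu(X_i)=\mu(v_i\circ X_i)\}$. Then $G$ is a $1$-König–Egerváry graph if and only if one of the following holds: (i) $H[F]=K_0$ (i.e. $F=\emptyset$), and exactly one of the $X_i$ is a $1$-König–Egerváry graph while all the others are König–Egerváry graphs; (ii) $H[F]=K_1$ and all $X_i$ are König–Egerváry graphs; (iii) $H[F]=K_2$ and all $X_i$ are König–Egerváry graphs.
   Context: All graphs are finite, simple and undirected. $n(G)$, $\alpha(G)$, $\mu(G)$ denote the number of vertices, independence number and maximum matching size. $G$ is König–Egerváry if $\alpha(G)+\mu(G)=n(G)$, and $1$-König–Egerváry if $\alpha(G)+\mu(G)=n(G)-1$. The corona $H\circ\mathcal{X}$ is obtained from the disjoint union of $H$ and $X_1,\dots,X_{n(H)}$ by joining each $v_i$ to all vertices of $X_i$; $v\circ X$ denotes $X$ plus a new vertex $v$ adjacent to all vertices of $X$. $H[F]$ is the subgraph of $H$ induced by $F$; $K_0$ is the graph with no vertices and $K_m$ the complete graph on $m$ vertices. -}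

module Defs where

open import Data.Nat using (ℕ; zero; suc; _+_; _≤_)
open import Data.Fin using (Fin; zero; suc; splitAt; _≟_)
open import Data.Bool using (Bool; true; false)
open import Data.Sum using (_⊎_; inj₁; inj₂)
open import Data.Product using (Σ; _×_; _,_; ∃; ∃-syntax)
open import Data.List using (List; []; _∷_; length; concatMap)
open import Data.List.Membership.Propositional using (_∈_)
open import Data.List.Relation.Unary.All using (All)
open import Data.List.Relation.Unary.Unique.Propositional using (Unique)
open import Relation.Binary.PropositionalEquality using (_≡_; _≢_; refl)
open import Relation.Nullary using (¬_; yes; no)

record Graph : Set where
  constructor mkGraph
  field
    n   : ℕ
    adj : Fin n → Fin n → Bool
open Graph public

IsSimple : Graph → Set
IsSimple G = (∀ u v → adj G u v ≡ adj G v u) × (∀ u → adj G u u ≡ false)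

IsIndependent : (G : Graph) → List (Fin (n G)) → Set
IsIndependent G S = Unique S × (∀ u v → u ∈ S → v ∈ S → adj G u v ≡ false)

endpoints : ∀ {k} → List (Fin k × Fin k) → List (Fin k)
endpoints = concatMap (λ { (u , v) → u ∷ v ∷ [] })

IsMatching : (G : Graph) → List (Fin (n G) × Fin (n G)) → Set
IsMatching G M = All (λ { (u , v) → adj G u v ≡ true }) M × Unique (endpoints M)

IsAlpha : Graph → ℕ → Set
IsAlpha G a = (Σ (List (Fin (n G))) λ S → IsIndependent G S × length S ≡ a)
            × (∀ S → IsIndependent G S → length S ≤ a)

IsMu : Graph → ℕ → Set
IsMu G m = (Σ (List (Fin (n G) × Fin (n G))) λ M → IsMatching G M × length M ≡ m)
         × (∀ M → IsMatching G M → length M ≤ m)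

IsKE : Graph → Set
IsKE G = ∃[ a ] ∃[ m ] (IsAlpha G a × IsMu G m × a + m ≡ n G)

Is1KE : Graph → Set
Is1KE G = ∃[ a ] ∃[ m ] (IsAlpha G a × IsMu G m × suc (a + m) ≡ n G)

cone : Graph → Graph
cone X = mkGraph (suc (n X)) a
  where
  a : Fin (suc (n X)) → Fin (suc (n X)) → Bool
  a zero    zero    = false
  a zero    (suc _) = true
  a (suc _) zero    = true
  a (suc x) (suc y) = adj X x y

total : (k : ℕ) → (Fin k → ℕ) → ℕ
total zero    f = 0
total (suc k) f = f zero + total k (λ i → f (suc i))

decode : (k : ℕ) (f : Fin k → ℕ) → Fin (total k f) → Σ (Fin k) (λ i → Fin (f i))
decode (suc k) f x with splitAt (f zero) x
... | inj₁ y = zero , y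
... | inj₂ y with decode k (λ i → f (suc i)) y
...   | i , z = suc i , z

-- Corona H ∘ X: vertices Fin (n H) (the copy of H) followed by the
-- disjoint union of the X i (in order i = 0,1,...).
corona : (H : Graph) → (Fin (n H) → Graph) → Graph
corona H X = mkGraph (n H + total (n H) (λ i → n (X i))) a
  where
  N : ℕ
  N = total (n H) (λ i → n (X i))
  dec : Fin N → Σ (Fin (n H)) (λ i → Fin (n (X i)))
  dec = decode (n H) (λ i → n (X i))
  sameIdx : Fin (n H) → Fin N → Bool
  sameIdx v y with dec y
  ... | i , _ with v ≟ i
  ...   | yes _ = true
  ...   | no _  = false
  inner : Σ (Fin (n H)) (λ i → Fin (n (X i))) → Σ (Fin (n H)) (λ i → Fin (n (X i))) → Bool
  inner (i , x) (j , y) with i ≟ j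
  ... | yes refl = adj (X i) x y
  ... | no _     = false
  a : Fin (n H + N) → Fin (n H + N) → Bool
  a u v with splitAt (n H) u | splitAt (n H) v
  ... | inj₁ p | inj₁ q = adj H p q
  ... | inj₁ p | inj₂ y = sameIdx p y
  ... | inj₂ y | inj₁ q = sameIdx q y
  ... | inj₂ y | inj₂ z = inner (dec y) (dec z)

InF : (H : Graph) → (Fin (n H) → Graph) → Fin (n H) → Set
InF H X i = ∃[ m ] (IsMu (X i) m × IsMu (cone (X i)) m)

InducedK0 : (H : Graph) → (Fin (n H) → Set) → Set
InducedK0 H P = ∀ v → ¬ P v

InducedK1 : (H : Graph) → (Fin (n H) → Set) → Set
InducedK1 H P = ∃[ v ] (P v × (∀ w → P w → w ≡ v))

InducedK2 : (H : Graph) → (Fin (n H) → Set) → Set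
InducedK2 H P = ∃[ v ] ∃[ w ] (v ≢ w × adj H v w ≡ true × P v × P w
                  × (∀ u → P u → u ≡ v ⊎ u ≡ w))

-- View a vertex of G = H ∘ 𝒳 as a pair (i , x) with x a vertex of the cone vᵢ ∘ Xᵢ.  As every Xᵢ is
-- nonempty, α(G) = Σ α(Xᵢ); as μ(Xᵢ) ≤ μ(vᵢ ∘ Xᵢ) ≤ μ(Xᵢ) + 1, counting vertices gives
-- n(G) = α(G) + S + |F| + δ with S = Σ μ(vᵢ ∘ Xᵢ) and δ = Σ (n(Xᵢ) − α(Xᵢ) − μ(Xᵢ)) ≥ 0.
-- Maximum matchings of the cones, chosen to miss vᵢ when vᵢ ∈ F, together with a matching of H[F]
-- form a matching of G, so S ≤ μ(G), with S < μ(G) if F spans an edge.  Conversely a matching M of G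
-- splits into matchings of the cones and a matching N of H, and each vertex vᵢ ∉ F covered by N costs
-- its cone an edge; hence |M| + |N| ≤ S + (number of F-vertices covered by N), so 2μ(G) ≤ 2S + |F|,
-- and μ(G) ≤ S when F is independent.  G is 1-KE iff μ(G) + 1 = S + |F| + δ, which leaves exactly
-- (|F|, δ) = (0, 1), (1, 0), or (2, 0) with μ(G) = S + 1, i.e. with an edge between the two F-vertices.

module Submission where

open import Defs
open import Data.Bool.Base using (Bool; true; false)
import Data.Bool.Properties as Bool
open import Data.Empty using (⊥)
open import Data.Fin.Base using (Fin; zero; suc; splitAt; _↑ˡ_; _↑ʳ_; fromℕ<)
open import Data.Fin.Properties using (_≟_; splitAt-↑ˡ; splitAt-↑ʳ; splitAt⁻¹-↑ˡ; splitAt⁻¹-↑ʳ)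
import Data.Fin.Properties as Fin
open import Data.List.Base
  using (List; []; _∷_; [_]; _++_; length; map; mapMaybe; filter; allFin; cartesianProductWith)
open import Data.List.Properties using (length-++; length-map; mapMaybe-nothing)
open import Data.List.Membership.Propositional using (_∈_; _∉_; find; lose)
open import Data.List.Membership.Propositional.Properties
  using (∈-allFin; ∈-filter⁺; ∈-filter⁻; ∈-map⁻; ∈-++⁻; ∈-cartesianProductWith⁺; ∈-cartesianProductWith⁻)
open import Data.List.Relation.Unary.Any using (here; there; any?)
open import Data.List.Relation.Unary.All as All using (All; []; _∷_; all?)
open import Data.List.Relation.Unary.All.Properties as All using (All¬⇒¬Any; ¬Any⇒All¬)
open import Data.List.Relation.Unary.Unique.Propositional using (Unique; []; _∷_)
import Data.List.Relation.Unary.Unique.Propositional.Properties as Unique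
open import Data.List.Relation.Unary.Unique.DecPropositional using (unique?)
open import Data.Maybe.Base using (Maybe; just; nothing; zip; is-just)
open import Data.Maybe using (Is-just)
open import Data.Maybe.Properties using (just-injective)
open import Data.Maybe.Relation.Unary.Any using (just)
open import Data.Nat.Base using (ℕ; zero; suc; _+_; _*_; _∸_; _≤_; z≤n; s≤s; s≤s⁻¹)
open import Data.Nat.ListAction using (sum)
open import Data.Nat.Properties
  using ( +-identityʳ; +-comm; +-assoc; +-suc; +-cancelˡ-≡; +-cancelˡ-≤; +-cancelʳ-≤
        ; +-mono-≤; +-monoˡ-≤; +-monoʳ-≤; +-mono-<; *-identityˡ; *-identityʳ; *-distribʳ-+
        ; ≤-reflexive; ≤-trans; ≤-antisym; ≤∧≢⇒<; <⇒≱; ≰⇒>; _≤?_; n≤0⇒n≡0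
        ; m≤m+n; m≤n+m; m+[n∸m]≡n; 1+n≰n; suc-injective; module ≤-Reasoning)
import Data.Nat.Properties as ℕ
open import Algebra.Properties.CommutativeSemigroup ℕ.+-commutativeSemigroup using (interchange; x∙yz≈y∙xz)
open import Data.Product.Base using (Σ; ∃; ∃-syntax; _×_; _,_; proj₁; proj₂)
open import Data.Sum.Base using (_⊎_; inj₁; inj₂)
open import Data.Unit.Base using (tt)
open import Function.Base using (_∘_)
open import Function.Bundles using (_⇔_; mk⇔; Equivalence)
open import Function.Properties.Equivalence using () renaming (sym to ⇔-sym)
open import Relation.Binary.Definitions using (DecidableEquality)
open import Relation.Binary.PropositionalEquality
  using (_≡_; _≢_; refl; sym; trans; cong; cong₂; subst; subst₂; module ≡-Reasoning)
open import Relation.Nullary using (¬_; Dec; yes; no; does; contradiction; _×-dec_)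
open import Relation.Nullary.Decidable using (map′; dec-true)
open import Relation.Unary using (Decidable)

module _ {k : ℕ} where
  open import Data.List.Membership.DecPropositional (_≟_ {k}) public using (_∈?_)

-- Indicators, sums over Fin, and counting duplicate-free lists

𝟙 : Bool → ℕ
𝟙 true  = 1
𝟙 false = 0

𝟙≤1 : ∀ b → 𝟙 b ≤ 1
𝟙≤1 true  = s≤s z≤n
𝟙≤1 false = z≤n

module _ {P : Set} where

  𝟙-yes : (P? : Dec P) → P → 𝟙 (does P?) ≡ 1
  𝟙-yes (yes _) _ = refl
  𝟙-yes (no ¬p) p = contradiction p ¬p

  𝟙-no : (P? : Dec P) → ¬ P → 𝟙 (does P?) ≡ 0
  𝟙-no (yes p) ¬p = contradiction p ¬p
  𝟙-no (no _)  _  = refl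

total-cong : ∀ k {f g : Fin k → ℕ} → (∀ i → f i ≡ g i) → total k f ≡ total k g
total-cong zero    f≗g = refl
total-cong (suc k) f≗g = cong₂ _+_ (f≗g zero) (total-cong k (f≗g ∘ suc))

total-mono-≤ : ∀ k {f g : Fin k → ℕ} → (∀ i → f i ≤ g i) → total k f ≤ total k g
total-mono-≤ zero    f≤g = z≤n
total-mono-≤ (suc k) f≤g = +-mono-≤ (f≤g zero) (total-mono-≤ k (f≤g ∘ suc))

total-distrib-+ : ∀ k (f g : Fin k → ℕ) → total k (λ i → f i + g i) ≡ total k f + total k g
total-distrib-+ zero    f g = refl
total-distrib-+ (suc k) f g =
  trans (cong (f zero + g zero +_) (total-distrib-+ k (f ∘ suc) (g ∘ suc)))
        (interchange (f zero) (g zero) (total k (f ∘ suc)) (total k (g ∘ suc)))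

term≤total : ∀ k (f : Fin k → ℕ) j → f j ≤ total k f
term≤total (suc k) f zero    = m≤m+n (f zero) _
term≤total (suc k) f (suc j) = ≤-trans (term≤total k (f ∘ suc) j) (m≤n+m _ (f zero))

total≡0⇒term≡0 : ∀ k (f : Fin k → ℕ) → total k f ≡ 0 → ∀ i → f i ≡ 0
total≡0⇒term≡0 k f Σ≡0 i = n≤0⇒n≡0 (subst (f i ≤_) Σ≡0 (term≤total k f i))

total-suc : ∀ k (f : Fin k → ℕ) → total k (λ i → suc (f i)) ≡ k + total k f
total-suc zero    f = refl
total-suc (suc k) f = cong suc (trans (cong (f zero +_) (total-suc k (f ∘ suc))) (x∙yz≈y∙xz (f zero) k _))

total-zero : ∀ k {f : Fin k → ℕ} → (∀ i → f i ≡ 0) → total k f ≡ 0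
total-zero zero    f≡0 = refl
total-zero (suc k) f≡0 = cong₂ _+_ (f≡0 zero) (total-zero k (f≡0 ∘ suc))

total-concentrated : ∀ k (f : Fin k → ℕ) j → (∀ i → i ≢ j → f i ≡ 0) → total k f ≡ f j
total-concentrated (suc k) f zero    off = trans (cong (f zero +_) (total-zero k (λ i → off (suc i) λ ()))) (+-identityʳ _)
total-concentrated (suc k) f (suc j) off =
  cong₂ _+_ (off zero λ ()) (total-concentrated k (f ∘ suc) j (λ i i≢j → off (suc i) (i≢j ∘ Fin.suc-injective)))

total≡1⇒concentrated : ∀ k (f : Fin k → ℕ) → total k f ≡ 1 → ∃[ j ] f j ≡ 1 × (∀ i → i ≢ j → f i ≡ 0)
total≡1⇒concentrated (suc k) f Σ≡1 with f zero in f₀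
... | 0 with total≡1⇒concentrated k (f ∘ suc) Σ≡1
...   | j , fj≡1 , off = suc j , fj≡1 , λ { zero _ → f₀ ; (suc i) i≢j → off i (i≢j ∘ cong suc) }
total≡1⇒concentrated (suc k) f Σ≡1 | 1 =
  zero , f₀ , λ { zero 0≢0 → contradiction refl 0≢0 ; (suc i) _ → total≡0⇒term≡0 k (f ∘ suc) (suc-injective Σ≡1) i }

module _ {k : ℕ} where

  𝟙-∈-∷ : ∀ {x : Fin k} {L} i → x ∉ L → 𝟙 (does (i ∈? x ∷ L)) ≡ 𝟙 (does (i ≟ x)) + 𝟙 (does (i ∈? L))
  𝟙-∈-∷ {x} {L} i x∉L with i ≟ x | i ∈? L
  ... | yes refl | yes i∈L = contradiction i∈L x∉L
  ... | yes _    | no _    = refl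
  ... | no _     | yes _   = refl
  ... | no _     | no _    = refl

  total-kronecker : (w : Fin k → ℕ) (x : Fin k) → total k (λ i → 𝟙 (does (i ≟ x)) * w i) ≡ w x
  total-kronecker w x = begin
    total k (λ i → 𝟙 (does (i ≟ x)) * w i) ≡⟨ total-concentrated k _ x (λ i i≢x → cong (_* w i) (𝟙-no (i ≟ x) i≢x)) ⟩
    𝟙 (does (x ≟ x)) * w x                 ≡⟨ cong (_* w x) (𝟙-yes (x ≟ x) refl) ⟩
    1 * w x                                ≡⟨ *-identityˡ (w x) ⟩
    w x                                    ∎
    where open ≡-Reasoning

  sum-map≡total : (w : Fin k → ℕ) {L : List (Fin k)} → Unique L →
                  sum (map w L) ≡ total k (λ i → 𝟙 (does (i ∈? L)) * w i)
  sum-map≡total w {[]}    []          = sym (total-zero k λ _ → refl)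
  sum-map≡total w {x ∷ L} (x≢L ∷ uL) = begin
    w x + sum (map w L)
      ≡⟨ cong₂ _+_ (sym (total-kronecker w x)) (sum-map≡total w uL) ⟩
    total k (λ i → 𝟙 (does (i ≟ x)) * w i) + total k (λ i → 𝟙 (does (i ∈? L)) * w i)
      ≡⟨ sym (total-distrib-+ k _ _) ⟩
    total k (λ i → 𝟙 (does (i ≟ x)) * w i + 𝟙 (does (i ∈? L)) * w i)
      ≡⟨ total-cong k (λ i → trans (cong (_* w i) (𝟙-∈-∷ i (All¬⇒¬Any x≢L)))
                                   (*-distribʳ-+ (w i) (𝟙 (does (i ≟ x))) (𝟙 (does (i ∈? L))))) ⟨
    total k (λ i → 𝟙 (does (i ∈? x ∷ L)) * w i)
      ∎
    where open ≡-Reasoning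

  length≡total : {L : List (Fin k)} → Unique L → length L ≡ total k (λ i → 𝟙 (does (i ∈? L)))
  length≡total {L} uL = begin
    length L                                    ≡⟨ length≡sum-map-1 L ⟩
    sum (map (λ _ → 1) L)                       ≡⟨ sum-map≡total (λ _ → 1) uL ⟩
    total k (λ i → 𝟙 (does (i ∈? L)) * 1)      ≡⟨ total-cong k (λ i → *-identityʳ _) ⟩
    total k (λ i → 𝟙 (does (i ∈? L)))          ∎
    where
    open ≡-Reasoning
    length≡sum-map-1 : ∀ (L : List (Fin k)) → length L ≡ sum (map (λ _ → 1) L)
    length≡sum-map-1 []      = refl
    length≡sum-map-1 (_ ∷ L) = cong suc (length≡sum-map-1 L)

  unique⇒length≤ : {L : List (Fin k)} → Unique L → length L ≤ k
  unique⇒length≤ {L} uL = begin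
    length L                             ≡⟨ length≡total uL ⟩
    total k (λ i → 𝟙 (does (i ∈? L)))   ≤⟨ total-mono-≤ k (λ i → 𝟙≤1 _) ⟩
    total k (λ _ → 1)                    ≡⟨ total-suc k (λ _ → 0) ⟩
    k + total k (λ _ → 0)                ≡⟨ cong (k +_) (total-zero k λ _ → refl) ⟩
    k + 0                                ≡⟨ +-identityʳ k ⟩
    k                                    ∎
    where open ≤-Reasoning

  module _ {P : Fin k → Set} (P? : Decidable P) where

    count : ℕ
    count = total k (λ i → 𝟙 (does (P? i)))

    enumerate : ∃[ L ] Unique L × (∀ {i} → P i → i ∈ L) × (∀ {i} → i ∈ L → P i)
    enumerate = filter P? (allFin k) , Unique.filter⁺ P? {allFin k} (Unique.allFin⁺ k)
              , (λ p → ∈-filter⁺ P? (∈-allFin _) p) , (λ i∈ → proj₂ (∈-filter⁻ P? {xs = allFin k} i∈))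

    count≡length : ∀ {L} → Unique L → (∀ {i} → P i → i ∈ L) → (∀ {i} → i ∈ L → P i) → count ≡ length L
    count≡length {L} uL P⇒∈ ∈⇒P = trans (total-cong k agree) (sym (length≡total uL))
      where
      agree : ∀ i → 𝟙 (does (P? i)) ≡ 𝟙 (does (i ∈? L))
      agree i with P? i | i ∈? L
      ... | yes _  | yes _  = refl
      ... | no _   | no _   = refl
      ... | yes p  | no i∉L = contradiction (P⇒∈ p) i∉L
      ... | no ¬p  | yes i∈ = contradiction (∈⇒P i∈) ¬p

-- IsAlpha G a and IsMu G m unfold to IsMaxSize (IsIndependent G) a and IsMaxSize (IsMatching G) m.
module _ {A : Set} where

  IsMaxSize : (List A → Set) → ℕ → Set
  IsMaxSize Q m = (Σ (List A) λ L → Q L × length L ≡ m) × (∀ L → Q L → length L ≤ m)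

  IsMaxSize-unique : ∀ {Q a b} → IsMaxSize Q a → IsMaxSize Q b → a ≡ b
  IsMaxSize-unique ((L , qL , refl) , ≤a) ((L′ , qL′ , refl) , ≤b) = ≤-antisym (≤b L qL) (≤a L′ qL′)

  IsMaxSize-cong : ∀ {Q Q′ m} → (∀ L → Q L ⇔ Q′ L) → IsMaxSize Q m → IsMaxSize Q′ m
  IsMaxSize-cong Q⇔Q′ ((L , qL , refl) , max) =
    (L , Equivalence.to (Q⇔Q′ L) qL , refl) , λ L′ q′ → max L′ (Equivalence.from (Q⇔Q′ L′) q′)

  tuples : List A → ℕ → List (List A)
  tuples xs zero    = [ [] ]
  tuples xs (suc k) = cartesianProductWith _∷_ xs (tuples xs k)

  ∈-tuples⁺ : ∀ {xs} → (∀ a → a ∈ xs) → ∀ L → L ∈ tuples xs (length L)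
  ∈-tuples⁺ every []      = here refl
  ∈-tuples⁺ every (a ∷ L) = ∈-cartesianProductWith⁺ _∷_ (every a) (∈-tuples⁺ every L)

  ∈-tuples⁻ : ∀ xs k {L} → L ∈ tuples xs k → length L ≡ k
  ∈-tuples⁻ xs zero    (here refl) = refl
  ∈-tuples⁻ xs (suc k) L∈ with ∈-cartesianProductWith⁻ _∷_ xs (tuples xs k) L∈
  ... | _ , L′ , _ , L′∈ , refl = cong suc (∈-tuples⁻ xs k L′∈)

largest : (P : ℕ → Set) → Decidable P → P 0 → ∀ B → (∀ k → P k → k ≤ B) → ∃[ m ] P m × (∀ k → P k → k ≤ m)
largest P P? P0 zero    ≤B = 0 , P0 , ≤B
largest P P? P0 (suc B) ≤B with P? (suc B)
... | yes PB = suc B , PB , ≤B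
... | no ¬PB = largest P P? P0 B λ k Pk → s≤s⁻¹ (≤∧≢⇒< (≤B k Pk) λ { refl → ¬PB Pk })

IsMaxSize-exists : ∀ {A : Set} (xs : List A) → (∀ a → a ∈ xs) → {Q : List A → Set} → Decidable Q → Q [] →
                   ∀ B → (∀ L → Q L → length L ≤ B) → ∃ (IsMaxSize Q)
IsMaxSize-exists {A} xs every {Q} Q? Q[] B ≤B =
  let m , witness , max = largest OfSize OfSize? ([] , Q[] , refl) B bounded
  in  m , witness , λ L qL → max (length L) (L , qL , refl)
  where
  OfSize : ℕ → Set
  OfSize k = ∃[ L ] Q L × length L ≡ k
  OfSize? : Decidable OfSize
  OfSize? k with any? Q? (tuples xs k)
  ... | yes some = let L , L∈ , qL = find some in yes (L , qL , ∈-tuples⁻ xs k L∈)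
  ... | no none  = no λ { (L , qL , refl) → none (lose (∈-tuples⁺ every L) qL) }
  bounded : ∀ k → OfSize k → k ≤ B
  bounded k (L , qL , refl) = ≤B L qL

-- Independent sets and matchings of graphs on an arbitrary vertex type

Adj : Set → Set
Adj A = A → A → Bool

ends : {A : Set} → List (A × A) → List A
ends []            = []
ends ((u , v) ∷ M) = u ∷ v ∷ ends M

module _ {A : Set} (E : Adj A) where

  Independent : List A → Set
  Independent S = Unique S × (∀ u v → u ∈ S → v ∈ S → E u v ≡ false)

  Matching : List (A × A) → Set
  Matching M = All (λ e → E (proj₁ e) (proj₂ e) ≡ true) M × Unique (ends M)

  module _ (_≟ᴬ_ : DecidableEquality A) where

    independent? : Decidable Independent
    independent? S = unique? _≟ᴬ_ S ×-dec
      map′ (λ none u v u∈ v∈ → All.lookup (All.lookup none u∈) v∈)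
           (λ none → All.tabulate λ {u} u∈ → All.tabulate λ {v} v∈ → none u v u∈ v∈)
           (all? (λ u → all? (λ v → E u v Bool.≟ false) S) S)

    matching? : Decidable Matching
    matching? M = all? (λ e → E (proj₁ e) (proj₂ e) Bool.≟ true) M ×-dec unique? _≟ᴬ_ (ends M)

module _ {A : Set} where

  _∈ₑ_ : A → A × A → Set
  w ∈ₑ e = w ≡ proj₁ e ⊎ w ≡ proj₂ e

  length-ends : (M : List (A × A)) → length (ends M) ≡ length M + length M
  length-ends []            = refl
  length-ends ((u , v) ∷ M) = cong suc (trans (cong suc (length-ends M)) (sym (+-suc (length M) (length M))))

  ∈-ends⁺ : ∀ {w e} {M : List (A × A)} → e ∈ M → w ∈ₑ e → w ∈ ends M
  ∈-ends⁺ {M = (u , v) ∷ M} (here refl) (inj₁ refl) = here refl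
  ∈-ends⁺ {M = (u , v) ∷ M} (here refl) (inj₂ refl) = there (here refl)
  ∈-ends⁺ {M = (u , v) ∷ M} (there e∈M) w∈e         = there (there (∈-ends⁺ e∈M w∈e))

  ∈-ends⁻ : ∀ {w} (M : List (A × A)) → w ∈ ends M → ∃[ e ] e ∈ M × w ∈ₑ e
  ∈-ends⁻ ((u , v) ∷ M) (here refl)         = (u , v) , here refl , inj₁ refl
  ∈-ends⁻ ((u , v) ∷ M) (there (here refl)) = (u , v) , here refl , inj₂ refl
  ∈-ends⁻ ((u , v) ∷ M) (there (there w∈))  = let e , e∈M , w∈e = ∈-ends⁻ M w∈ in e , there e∈M , w∈e

  ends-unique-head : ∀ {w e} {M : List (A × A)} → Unique (ends (e ∷ M)) → w ∈ₑ e → w ∉ ends M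
  ends-unique-head {e = u , v} (u∉ ∷ _)      (inj₁ refl) w∈ = All¬⇒¬Any u∉ (there w∈)
  ends-unique-head {e = u , v} (_ ∷ v∉ ∷ _)  (inj₂ refl) w∈ = All¬⇒¬Any v∉ w∈

  ends-unique-tail : ∀ {e} {M : List (A × A)} → Unique (ends (e ∷ M)) → Unique (ends M)
  ends-unique-tail {e = u , v} (_ ∷ _ ∷ uM) = uM

  same-edge : ∀ {w e e′} {M : List (A × A)} → Unique (ends M) → e ∈ M → e′ ∈ M → w ∈ₑ e → w ∈ₑ e′ → e ≡ e′
  same-edge uM (here refl) (here refl)  _   _    = refl
  same-edge uM (here refl) (there e′∈)  w∈e w∈e′ = contradiction (∈-ends⁺ e′∈ w∈e′) (ends-unique-head uM w∈e)
  same-edge uM (there e∈)  (here refl)  w∈e w∈e′ = contradiction (∈-ends⁺ e∈ w∈e) (ends-unique-head uM w∈e′)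
  same-edge uM (there e∈)  (there e′∈)  w∈e w∈e′ = same-edge (ends-unique-tail uM) e∈ e′∈ w∈e w∈e′

  ends-unique⇒loopless : ∀ {e} {M : List (A × A)} → Unique (ends M) → e ∈ M → proj₁ e ≢ proj₂ e
  ends-unique⇒loopless {M = (u , v) ∷ M} (u∉ ∷ _) (here refl) refl = All¬⇒¬Any u∉ (here refl)
  ends-unique⇒loopless (_ ∷ _ ∷ uM) (there e∈) = ends-unique⇒loopless uM e∈

  map-endpoint-unique : (pick : A × A → A) → (∀ e → pick e ∈ₑ e) →
                        ∀ {M} → Unique (ends M) → Unique (map pick M)
  map-endpoint-unique pick pick∈ {[]}    _  = []
  map-endpoint-unique pick pick∈ {e ∷ M} uM = All.tabulate fresh ∷ map-endpoint-unique pick pick∈ (ends-unique-tail uM)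
    where
    fresh : ∀ {x} → x ∈ map pick M → pick e ≢ x
    fresh x∈ refl = let e′ , e′∈ , x≡ = ∈-map⁻ pick x∈ in
      ends-unique-head uM (pick∈ e) (∈-ends⁺ e′∈ (subst (_∈ₑ e′) (sym x≡) (pick∈ e′)))

endpoints≡ends : ∀ {k} (M : List (Fin k × Fin k)) → endpoints M ≡ ends M
endpoints≡ends []            = refl
endpoints≡ends ((u , v) ∷ M) = cong (λ w → u ∷ v ∷ w) (endpoints≡ends M)

IsMatching⇔Matching : (G : Graph) (M : List (Fin (n G) × Fin (n G))) → IsMatching G M ⇔ Matching (adj G) M
IsMatching⇔Matching G M = mk⇔
  (λ (edges , u) → All.map (λ { {_ , _} e → e }) edges , subst Unique (endpoints≡ends M) u)
  (λ (edges , u) → All.map (λ { {_ , _} e → e }) edges , subst Unique (sym (endpoints≡ends M)) u)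

IsMu⇔ : (G : Graph) {m : ℕ} → IsMu G m ⇔ IsMaxSize (Matching (adj G)) m
IsMu⇔ G = mk⇔ (IsMaxSize-cong (IsMatching⇔Matching G))
              (IsMaxSize-cong (λ M → ⇔-sym (IsMatching⇔Matching G M)))

module _ {k : ℕ} {E : Adj (Fin k)} where

  matching⇒length≤ : ∀ {M} → Matching E M → length M ≤ k
  matching⇒length≤ {M} (_ , uM) =
    ≤-trans (m≤m+n (length M) (length M)) (subst (_≤ k) (length-ends M) (unique⇒length≤ uM))

  independent+matching≤ : ∀ {S M} → Independent E S → Matching E M → length S + length M ≤ k
  independent+matching≤ {S} {M} (uS , indS) (edges , uM) =
    subst (_≤ k) (trans (length-++ S) (cong (length S +_) (length-map outside M)))
      (unique⇒length≤ (Unique.++⁺ uS (map-endpoint-unique outside outside∈ uM) disjoint))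
    where
    outside : Fin k × Fin k → Fin k
    outside (u , v) with u ∈? S
    ... | yes _ = v
    ... | no _  = u
    outside∈ : ∀ e → outside e ∈ₑ e
    outside∈ (u , v) with u ∈? S
    ... | yes _ = inj₂ refl
    ... | no _  = inj₁ refl
    outside∉S : ∀ {e} → e ∈ M → outside e ∉ S
    outside∉S {u , v} e∈ with u ∈? S
    ... | yes u∈ = λ v∈ → contradiction (trans (sym (indS u v u∈ v∈)) (All.lookup edges e∈)) λ ()
    ... | no u∉  = u∉
    disjoint : ∀ {w} → ¬ (w ∈ S × w ∈ map outside M)
    disjoint (w∈S , w∈) with ∈-map⁻ outside w∈
    ... | e , e∈ , refl = outside∉S e∈ w∈S

α-exists : (G : Graph) → ∃ (IsAlpha G)
α-exists G = IsMaxSize-exists (allFin (n G)) ∈-allFin (independent? (adj G) _≟_) ([] , λ _ _ ()) (n G)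
               λ _ (uS , _) → unique⇒length≤ uS

μ-exists : (G : Graph) → ∃ (IsMu G)
μ-exists G =
  let m , max = IsMaxSize-exists (cartesianProductWith _,_ (allFin (n G)) (allFin (n G)))
                  (λ (u , v) → ∈-cartesianProductWith⁺ _,_ (∈-allFin u) (∈-allFin v))
                  (matching? (adj G) _≟_) ([] , []) (n G) (λ _ → matching⇒length≤)
  in m , Equivalence.from (IsMu⇔ G) max

-- Partial embeddings, isomorphisms and disjoint unions

module _ {A B : Set} (p : A → Maybe B) where

  ∈-mapMaybe⁻ : ∀ {b} xs → b ∈ mapMaybe p xs → ∃[ a ] a ∈ xs × p a ≡ just b
  ∈-mapMaybe⁻ (x ∷ xs) b∈ with p x in px
  ∈-mapMaybe⁻ (x ∷ xs) b∈          | nothing = let a , a∈ , pa = ∈-mapMaybe⁻ xs b∈ in a , there a∈ , pa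
  ∈-mapMaybe⁻ (x ∷ xs) (here refl) | just _  = x , here refl , px
  ∈-mapMaybe⁻ (x ∷ xs) (there b∈)  | just _  = let a , a∈ , pa = ∈-mapMaybe⁻ xs b∈ in a , there a∈ , pa

  length-mapMaybe-∷ : ∀ x xs → length (mapMaybe p (x ∷ xs)) ≡ 𝟙 (is-just (p x)) + length (mapMaybe p xs)
  length-mapMaybe-∷ x xs with p x
  ... | nothing = refl
  ... | just _  = refl

  length-mapMaybe-defined : ∀ xs → (∀ {a} → a ∈ xs → Is-just (p a)) → length (mapMaybe p xs) ≡ length xs
  length-mapMaybe-defined []       _       = refl
  length-mapMaybe-defined (x ∷ xs) defined with p x | defined (here refl)
  ... | just _ | just _ = cong suc (length-mapMaybe-defined xs (defined ∘ there))

Is-just⇒𝟙≡1 : ∀ {B : Set} {m : Maybe B} → Is-just m → 𝟙 (is-just m) ≡ 1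
Is-just⇒𝟙≡1 (just _) = refl

length≤parts : ∀ {A C : Set} {k} {B : Fin k → Set} (q : ∀ i → A → Maybe (B i)) (r : A → Maybe C) {xs} →
               All (λ a → (∃[ i ] Is-just (q i a)) ⊎ Is-just (r a)) xs →
               length xs ≤ total k (λ i → length (mapMaybe (q i) xs)) + length (mapMaybe r xs)
length≤parts         q r {[]}     []           = z≤n
length≤parts {A} {k = k} q r {x ∷ xs} (some ∷ all) = begin
  suc (length xs)
    ≤⟨ +-mono-≤ (counted some) (length≤parts q r all) ⟩
  (hits + 𝟙 (is-just (r x))) + (total k (parts xs) + length (mapMaybe r xs))
    ≡⟨ interchange hits _ _ _ ⟩
  (hits + total k (parts xs)) + (𝟙 (is-just (r x)) + length (mapMaybe r xs))
    ≡⟨ cong₂ _+_ (sym (total-distrib-+ k _ _)) (sym (length-mapMaybe-∷ r x xs)) ⟩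
  total k (λ i → 𝟙 (is-just (q i x)) + parts xs i) + length (mapMaybe r (x ∷ xs))
    ≡⟨ cong (_+ length (mapMaybe r (x ∷ xs))) (total-cong k λ i → sym (length-mapMaybe-∷ (q i) x xs)) ⟩
  total k (parts (x ∷ xs)) + length (mapMaybe r (x ∷ xs))
    ∎
  where
  open ≤-Reasoning
  parts : List A → Fin k → ℕ
  parts ys i = length (mapMaybe (q i) ys)
  hits : ℕ
  hits = total k (λ i → 𝟙 (is-just (q i x)))
  counted : (∃[ i ] Is-just (q i x)) ⊎ Is-just (r x) → 1 ≤ hits + 𝟙 (is-just (r x))
  counted (inj₁ (i , qix)) = ≤-trans (≤-trans (≤-reflexive (sym (Is-just⇒𝟙≡1 qix))) (term≤total k _ i)) (m≤m+n _ _)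
  counted (inj₂ rx)        = ≤-trans (≤-reflexive (sym (Is-just⇒𝟙≡1 rx))) (m≤n+m _ _)

length≤cover : ∀ {A : Set} {k} {B : Fin k → Set} (q : ∀ i → A → Maybe (B i)) {xs} →
               All (λ a → ∃[ i ] Is-just (q i a)) xs → length xs ≤ total k (λ i → length (mapMaybe (q i) xs))
length≤cover {k = k} q {xs} covered = begin
  length xs
    ≤⟨ length≤parts q (λ _ → nothing) {xs} (All.map inj₁ covered) ⟩
  total k (λ i → length (mapMaybe (q i) xs)) + length (mapMaybe {B = ⊥} (λ _ → nothing) xs)
    ≡⟨ cong (λ L → total k (λ i → length (mapMaybe (q i) xs)) + length L) (mapMaybe-nothing xs) ⟩
  total k (λ i → length (mapMaybe (q i) xs)) + 0
    ≡⟨ +-identityʳ _ ⟩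
  total k (λ i → length (mapMaybe (q i) xs))
    ∎
  where open ≤-Reasoning

zip≡just : ∀ {A B : Set} (a : Maybe A) (b : Maybe B) {x y} → zip a b ≡ just (x , y) → a ≡ just x × b ≡ just y
zip≡just (just _) (just _) refl = refl , refl

record PartialEmbedding {A B : Set} (E : Adj A) (E′ : Adj B) : Set where
  field
    apply     : A → Maybe B
    injective : ∀ {a a′ b} → apply a ≡ just b → apply a′ ≡ just b → a ≡ a′
    adjacent  : ∀ {a a′ b b′} → apply a ≡ just b → apply a′ ≡ just b′ → E′ b b′ ≡ E a a′

  apply² : A × A → Maybe (B × B)
  apply² (u , v) = zip (apply u) (apply v)

  image : List A → List B
  image = mapMaybe apply

  image² : List (A × A) → List (B × B)
  image² = mapMaybe apply²

  Total : Set
  Total = ∀ a → Is-just (apply a)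

embedding : ∀ {A B : Set} {E : Adj A} {E′ : Adj B} (f : A → B) →
            (∀ {a a′} → f a ≡ f a′ → a ≡ a′) → (∀ a a′ → E′ (f a) (f a′) ≡ E a a′) → PartialEmbedding E E′
embedding f f-injective f-adjacent = record
  { apply     = just ∘ f
  ; injective = λ fa fa′ → f-injective (just-injective (trans fa (sym fa′)))
  ; adjacent  = λ { {a} {a′} refl refl → f-adjacent a a′ }
  }

module Image {A B : Set} {E : Adj A} {E′ : Adj B} (φ : PartialEmbedding E E′) where
  open PartialEmbedding φ

  image-unique : ∀ {xs} → Unique xs → Unique (image xs)
  image-unique {[]}     []          = []
  image-unique {x ∷ xs} (x≢xs ∷ uxs) with apply x in ax
  ... | nothing = image-unique uxs
  ... | just b  = ¬Any⇒All¬ _ b∉ ∷ image-unique uxs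
    where
    b∉ : b ∉ image xs
    b∉ b∈ = let a , a∈ , aa = ∈-mapMaybe⁻ apply xs b∈ in All¬⇒¬Any x≢xs (subst (_∈ xs) (injective aa ax) a∈)

  image-independent : ∀ {S} → Independent E S → Independent E′ (image S)
  image-independent {S} (uS , indS) = image-unique uS , λ u v u∈ v∈ →
    let a , a∈ , aa = ∈-mapMaybe⁻ apply S u∈
        b , b∈ , ab = ∈-mapMaybe⁻ apply S v∈
    in  trans (adjacent aa ab) (indS a b a∈ b∈)

  ∈-ends-image²⇒edge : ∀ {b} M → b ∈ ends (image² M) →
                  ∃[ e ] e ∈ M × Is-just (apply² e) × ∃[ a ] a ∈ₑ e × apply a ≡ just b
  ∈-ends-image²⇒edge M b∈ with ∈-ends⁻ (image² M) b∈
  ... | (x , y) , e′∈ , b∈e′ with ∈-mapMaybe⁻ apply² M e′∈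
  ... | (u , v) , e∈ , ae with zip≡just (apply u) (apply v) ae | b∈e′
  ...   | au , av | inj₁ refl = (u , v) , e∈ , subst Is-just (sym ae) (just tt) , u , inj₁ refl , au
  ...   | au , av | inj₂ refl = (u , v) , e∈ , subst Is-just (sym ae) (just tt) , v , inj₂ refl , av

  ∈-ends-image²⁻ : ∀ {b} M → b ∈ ends (image² M) → ∃[ a ] a ∈ ends M × apply a ≡ just b
  ∈-ends-image²⁻ M b∈ = let e , e∈ , _ , a , a∈e , aa = ∈-ends-image²⇒edge M b∈ in a , ∈-ends⁺ e∈ a∈e , aa

  image-matching : ∀ {M} → Matching E M → Matching E′ (image² M)
  image-matching {[]}          ([] , _)            = [] , []
  image-matching {(u , v) ∷ M} (uv ∷ edges , uniq) with apply u in au | apply v in av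
  ... | nothing | _       = image-matching (edges , ends-unique-tail uniq)
  ... | just x  | nothing = image-matching (edges , ends-unique-tail uniq)
  ... | just x  | just y  = trans (adjacent au av) uv ∷ proj₁ rest , ¬Any⇒All¬ _ x∉ ∷ ¬Any⇒All¬ _ y∉ ∷ proj₂ rest
    where
    rest : Matching E′ (image² M)
    rest = image-matching (edges , ends-unique-tail uniq)
    fresh : ∀ {a b} → a ∈ₑ (u , v) → apply a ≡ just b → b ∉ ends (image² M)
    fresh a∈e aa b∈ = let a′ , a′∈ , aa′ = ∈-ends-image²⁻ M b∈ in
      ends-unique-head uniq a∈e (subst (_∈ ends M) (injective aa′ aa) a′∈)
    y∉ : y ∉ ends (image² M)
    y∉ = fresh (inj₂ refl) av
    x∉ : x ∉ y ∷ ends (image² M)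
    x∉ (here refl) = ends-unique⇒loopless uniq (here refl) (injective au av)
    x∉ (there x∈)  = fresh (inj₁ refl) au x∈

  length-image : Total → ∀ xs → length (image xs) ≡ length xs
  length-image total xs = length-mapMaybe-defined apply xs (λ {a} _ → total a)

  length-image² : Total → ∀ M → length (image² M) ≡ length M
  length-image² total M = length-mapMaybe-defined apply² M λ { {u , v} _ → defined (total u) (total v) }
    where
    defined : ∀ {a b : Maybe B} → Is-just a → Is-just b → Is-just (zip a b)
    defined (just _) (just _) = just tt

record _≅_ {A B : Set} (E : Adj A) (E′ : Adj B) : Set where
  field
    to       : A → B
    from     : B → A
    from-to  : ∀ a → from (to a) ≡ a
    to-from  : ∀ b → to (from b) ≡ b
    adjacent : ∀ a a′ → E′ (to a) (to a′) ≡ E a a′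

  forward : PartialEmbedding E E′
  forward = embedding to (λ {a} {a′} eq → trans (sym (from-to a)) (trans (cong from eq) (from-to a′))) adjacent

≅-sym : ∀ {A B : Set} {E : Adj A} {E′ : Adj B} → E ≅ E′ → E′ ≅ E
≅-sym {E′ = E′} iso = record
  { to       = from
  ; from     = to
  ; from-to  = to-from
  ; to-from  = from-to
  ; adjacent = λ b b′ → trans (sym (adjacent (from b) (from b′))) (cong₂ E′ (to-from b) (to-from b′))
  }
  where open _≅_ iso

module _ {A B : Set} {E : Adj A} {E′ : Adj B} (iso : E ≅ E′) where
  open _≅_ iso using (forward)
  open _≅_ (≅-sym iso) using () renaming (forward to backward)
  open Image forward  using () renaming (image-independent to to-independent; image-matching to to-matching)
  open Image backward using () renaming (image-independent to from-independent; image-matching to from-matching)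

  ≅-α : ∀ {a} → IsMaxSize (Independent E) a → IsMaxSize (Independent E′) a
  ≅-α ((S , indS , refl) , max) =
      (_ , to-independent indS , Image.length-image forward (λ _ → just tt) S)
    , λ S′ ind′ → subst (_≤ _) (Image.length-image backward (λ _ → just tt) S′) (max _ (from-independent ind′))

  ≅-μ : ∀ {m} → IsMaxSize (Matching E) m → IsMaxSize (Matching E′) m
  ≅-μ ((M , mM , refl) , max) =
      (_ , to-matching mM , Image.length-image² forward (λ _ → just tt) M)
    , λ M′ m′ → subst (_≤ _) (Image.length-image² backward (λ _ → just tt) M′) (max _ (from-matching m′))

⋃ : ∀ {C : Set} k → (Fin k → List C) → List C
⋃ zero    L = []
⋃ (suc k) L = L zero ++ ⋃ k (L ∘ suc)

module _ {C : Set} where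

  length-⋃ : ∀ k (L : Fin k → List C) → length (⋃ k L) ≡ total k (length ∘ L)
  length-⋃ zero    L = refl
  length-⋃ (suc k) L = trans (length-++ (L zero)) (cong (length (L zero) +_) (length-⋃ k (L ∘ suc)))

  ∈-⋃⁻ : ∀ k (L : Fin k → List C) {c} → c ∈ ⋃ k L → ∃[ i ] c ∈ L i
  ∈-⋃⁻ (suc k) L c∈ with ∈-++⁻ (L zero) c∈
  ... | inj₁ c∈₀ = zero , c∈₀
  ... | inj₂ c∈ʳ = let i , c∈ᵢ = ∈-⋃⁻ k (L ∘ suc) c∈ʳ in suc i , c∈ᵢ

  ⋃-unique : ∀ k (L : Fin k → List C) → (∀ i → Unique (L i)) →
             (∀ {i j c} → c ∈ L i → c ∈ L j → i ≡ j) → Unique (⋃ k L)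
  ⋃-unique zero    L _ _        = []
  ⋃-unique (suc k) L u disjoint =
    Unique.++⁺ (u zero) (⋃-unique k (L ∘ suc) (u ∘ suc) (λ c∈ c∈′ → Fin.suc-injective (disjoint c∈ c∈′)))
      λ (c∈₀ , c∈ʳ) → let i , c∈ᵢ = ∈-⋃⁻ k (L ∘ suc) c∈ʳ in contradiction (disjoint c∈₀ c∈ᵢ) λ ()

module _ {A : Set} {E : Adj A} where

  ends-++ : ∀ (M M′ : List (A × A)) → ends (M ++ M′) ≡ ends M ++ ends M′
  ends-++ []            M′ = refl
  ends-++ ((u , v) ∷ M) M′ = cong (λ w → u ∷ v ∷ w) (ends-++ M M′)

  ++-matching : ∀ {M M′} → Matching E M → Matching E M′ → (∀ {w} → ¬ (w ∈ ends M × w ∈ ends M′)) →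
                Matching E (M ++ M′)
  ++-matching {M} {M′} (edges , uM) (edges′ , uM′) disjoint =
    All.++⁺ edges edges′ , subst Unique (sym (ends-++ M M′)) (Unique.++⁺ uM uM′ disjoint)

  ⋃-matching : ∀ k (M : Fin k → List (A × A)) → (∀ i → Matching E (M i)) →
               (∀ {i j w} → w ∈ ends (M i) → w ∈ ends (M j) → i ≡ j) → Matching E (⋃ k M)
  ⋃-matching zero    M _ _        = [] , []
  ⋃-matching (suc k) M m disjoint =
    ++-matching (m zero) (⋃-matching k (M ∘ suc) (m ∘ suc) (λ w∈ w∈′ → Fin.suc-injective (disjoint w∈ w∈′)))
      λ (w∈₀ , w∈ʳ) → let i , e , e∈ , w∈e = in-piece w∈ʳ in
        contradiction (disjoint w∈₀ (∈-ends⁺ e∈ w∈e)) λ ()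
    where
    in-piece : ∀ {w} → w ∈ ends (⋃ k (M ∘ suc)) → ∃[ i ] ∃[ e ] e ∈ M (suc i) × w ∈ₑ e
    in-piece w∈ = let e , e∈ , w∈e = ∈-ends⁻ _ w∈ ; i , e∈ᵢ = ∈-⋃⁻ k (M ∘ suc) e∈ in i , e , e∈ᵢ , w∈e

  ⋃-independent : ∀ k (S : Fin k → List A) → (∀ i → Unique (S i)) → (∀ {i j c} → c ∈ S i → c ∈ S j → i ≡ j) →
                  (∀ {i j u v} → u ∈ S i → v ∈ S j → E u v ≡ false) → Independent E (⋃ k S)
  ⋃-independent k S u disjoint nonadjacent = ⋃-unique k S u disjoint , λ _ _ u∈ v∈ →
    nonadjacent (proj₂ (∈-⋃⁻ k S u∈)) (proj₂ (∈-⋃⁻ k S v∈))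

-- Cones v ∘ X, with apex zero

module Cone (X : Graph) where

  drop-apex : PartialEmbedding (adj (cone X)) (adj X)
  drop-apex = record
    { apply     = λ { zero → nothing ; (suc x) → just x }
    ; injective = λ { {suc _} {suc _} refl refl → refl }
    ; adjacent  = λ { {suc _} {suc _} refl refl → refl }
    }

  lift : PartialEmbedding (adj X) (adj (cone X))
  lift = embedding suc (λ { refl → refl }) (λ _ _ → refl)

  open PartialEmbedding
  open Image

  apex-free⇒length-drop : ∀ M → zero ∉ ends M → length (image² drop-apex M) ≡ length M
  apex-free⇒length-drop M apex∉ = length-mapMaybe-defined (apply² drop-apex) M defined
    where
    defined : ∀ {e} → e ∈ M → Is-just (apply² drop-apex e)
    defined {zero  , _    } e∈ = contradiction (∈-ends⁺ e∈ (inj₁ refl)) apex∉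
    defined {suc _ , zero } e∈ = contradiction (∈-ends⁺ e∈ (inj₂ refl)) apex∉
    defined {suc _ , suc _} e∈ = just tt

  lift-apex-free : ∀ M → zero ∉ ends (image² lift M)
  lift-apex-free M apex∈ with ∈-ends-image²⁻ lift M apex∈
  ... | _ , _ , ()

  length≤suc-drop : ∀ M → Unique (ends M) → length M ≤ suc (length (image² drop-apex M))
  length≤suc-drop []                    _    = z≤n
  length≤suc-drop ((suc x , suc y) ∷ M) uniq = s≤s (length≤suc-drop M (ends-unique-tail uniq))
  length≤suc-drop ((zero  , v    ) ∷ M) uniq =
    s≤s (≤-reflexive (sym (apex-free⇒length-drop M (ends-unique-head uniq (inj₁ refl)))))
  length≤suc-drop ((suc x , zero ) ∷ M) uniq =
    s≤s (≤-reflexive (sym (apex-free⇒length-drop M (ends-unique-head uniq (inj₂ refl)))))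

  module _ {a : ℕ} (α : IsAlpha X a) where

    independent≤α : ∀ x → adj X x x ≡ false → ∀ {T} → Independent (adj (cone X)) T → length T ≤ a
    independent≤α x loop {T} indT@(uT , adjT) with zero ∈? T
    ... | yes apex∈ = ≤-trans (at-most-one T uT only-apex) (proj₂ α [ x ] (([] ∷ []) , λ { _ _ (here refl) (here refl) → loop }))
      where
      only-apex : ∀ {v} → v ∈ T → v ≡ zero
      only-apex {zero}  _  = refl
      only-apex {suc _} v∈ = contradiction (adjT zero _ apex∈ v∈) λ ()
      at-most-one : ∀ T → Unique T → (∀ {v} → v ∈ T → v ≡ zero) → length T ≤ 1
      at-most-one []          _            _    = z≤n
      at-most-one (_ ∷ [])    _            _    = s≤s z≤n
      at-most-one (u ∷ v ∷ _) (u≢ ∷ _) zero! =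
        contradiction (trans (zero! (here refl)) (sym (zero! (there (here refl))))) (All.head u≢)
    ... | no apex∉ = subst (_≤ a) (length-mapMaybe-defined (apply drop-apex) T defined)
                       (proj₂ α _ (image-independent drop-apex indT))
      where
      defined : ∀ {v} → v ∈ T → Is-just (apply drop-apex v)
      defined {zero}  v∈ = contradiction v∈ apex∉
      defined {suc _} _  = just tt

  module _ {m : ℕ} (μˣ : IsMu X m) where

    private
      μ : IsMaxSize (Matching (adj X)) m
      μ = Equivalence.to (IsMu⇔ X) μˣ

    apex-free-matching≤μ : ∀ {M} → Matching (adj (cone X)) M → zero ∉ ends M → length M ≤ m
    apex-free-matching≤μ {M} mM apex∉ =
      subst (_≤ m) (apex-free⇒length-drop M apex∉) (proj₂ μ _ (image-matching drop-apex mM))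

    lifted-maximum : ∃[ M ] Matching (adj (cone X)) M × length M ≡ m × zero ∉ ends M
    lifted-maximum = let M , mM , |M| = proj₁ μ in
      image² lift M , image-matching lift mM , trans (length-image² lift (λ _ → just tt) M) |M| , lift-apex-free M

    module _ {mᶜ : ℕ} (μᶜˣ : IsMu (cone X) mᶜ) where

      private
        μᶜ : IsMaxSize (Matching (adj (cone X))) mᶜ
        μᶜ = Equivalence.to (IsMu⇔ (cone X)) μᶜˣ

      μ≤μᶜ : m ≤ mᶜ
      μ≤μᶜ = let M , mM , |M| , _ = lifted-maximum in subst (_≤ mᶜ) |M| (proj₂ μᶜ M mM)

      μᶜ≤suc-μ : mᶜ ≤ suc m
      μᶜ≤suc-μ = let M , (edges , uM) , |M| = proj₁ μᶜ in
        subst (_≤ suc m) |M| (≤-trans (length≤suc-drop M uM) (s≤s (proj₂ μ _ (image-matching drop-apex (edges , uM)))))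

      μᶜ+𝟙≡suc-μ : (mᶜ≟m : Dec (mᶜ ≡ m)) → mᶜ + 𝟙 (does mᶜ≟m) ≡ suc m
      μᶜ+𝟙≡suc-μ (yes refl) = +-comm mᶜ 1
      μᶜ+𝟙≡suc-μ (no mᶜ≢m)  = trans (+-identityʳ mᶜ) (≤-antisym μᶜ≤suc-μ (≤∧≢⇒< μ≤μᶜ (mᶜ≢m ∘ sym)))

      apex-avoiding-maximum : ∃[ M ] Matching (adj (cone X)) M × length M ≡ mᶜ × (mᶜ ≡ m → zero ∉ ends M)
      apex-avoiding-maximum with mᶜ ℕ.≟ m
      ... | yes refl = let M , mM , |M| , apex∉ = lifted-maximum in M , mM , |M| , λ _ → apex∉
      ... | no mᶜ≢m  = let M , mM , |M| = proj₁ μᶜ in M , mM , |M| , λ mᶜ≡m → contradiction mᶜ≡m mᶜ≢m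

-- The corona H ∘ 𝒳

encode : ∀ k (f : Fin k → ℕ) i → Fin (f i) → Fin (total k f)
encode (suc k) f zero    x = x ↑ˡ total k (f ∘ suc)
encode (suc k) f (suc i) x = f zero ↑ʳ encode k (f ∘ suc) i x

decode-encode : ∀ k (f : Fin k → ℕ) i x → decode k f (encode k f i x) ≡ (i , x)
decode-encode (suc k) f zero x rewrite splitAt-↑ˡ (f zero) x (total k (f ∘ suc)) = refl
decode-encode (suc k) f (suc i) x
  rewrite splitAt-↑ʳ (f zero) (total k (f ∘ suc)) (encode k (f ∘ suc) i x)
        | decode-encode k (f ∘ suc) i x = refl

encode-decode : ∀ k (f : Fin k → ℕ) y → encode k f (proj₁ (decode k f y)) (proj₂ (decode k f y)) ≡ y
encode-decode (suc k) f y with splitAt (f zero) y in split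
... | inj₁ _ = splitAt⁻¹-↑ˡ split
... | inj₂ z with decode k (f ∘ suc) z | encode-decode k (f ∘ suc) z
...   | _ , _ | encode≡ = trans (cong (f zero ↑ʳ_) encode≡) (splitAt⁻¹-↑ʳ split)

module Corona (H : Graph) (X : Fin (n H) → Graph) where

  open PartialEmbedding using (apply²; image²)

  V : Set
  V = Σ (Fin (n H)) λ i → Fin (suc (n (X i)))

  -- (i , zero) is the vertex vᵢ of H and (i , suc x) is the vertex x of Xᵢ.
  E : Adj V
  E (i , zero)  (j , zero)  = adj H i j
  E (i , zero)  (j , suc _) = does (i ≟ j)
  E (i , suc _) (j , zero)  = does (j ≟ i)
  E (i , suc x) (j , suc y) with i ≟ j
  ... | yes refl = adj (X i) x y
  ... | no _     = false

  E-within : IsSimple H → ∀ i x y → E (i , x) (i , y) ≡ adj (cone (X i)) x y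
  E-within (_ , loopless) i zero    zero    = loopless i
  E-within _              i zero    (suc y) = dec-true (i ≟ i) refl
  E-within _              i (suc x) zero    = dec-true (i ≟ i) refl
  E-within _              i (suc x) (suc y) with i ≟ i
  ... | yes refl = refl
  ... | no i≢i   = contradiction refl i≢i

  data Edge : V → V → Set where
    within  : ∀ i x y → Edge (i , x) (i , y)
    between : ∀ i j → Edge (i , zero) (j , zero)

  edge-view : ∀ u v → E u v ≡ true → Edge u v
  edge-view (i , zero)  (j , zero)  _  = between i j
  edge-view (i , zero)  (j , suc y) uv with i ≟ j
  ... | yes refl = within i zero (suc y)
  ... | no _     = contradiction uv λ ()
  edge-view (i , suc x) (j , zero)  uv with j ≟ i
  ... | yes refl = within j (suc x) zero
  ... | no _     = contradiction uv λ ()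
  edge-view (i , suc x) (j , suc y) uv with i ≟ j
  ... | yes refl = within i (suc x) (suc y)
  ... | no _     = contradiction uv λ ()

  N : ℕ
  N = total (n H) (λ i → n (X i))

  encodeX : ∀ i → Fin (n (X i)) → Fin N
  encodeX = encode (n H) (λ i → n (X i))

  toFin : V → Fin (n (corona H X))
  toFin (i , zero)  = i ↑ˡ N
  toFin (i , suc x) = n H ↑ʳ encodeX i x

  fromFin : Fin (n (corona H X)) → V
  fromFin v with splitAt (n H) v
  ... | inj₁ i = i , zero
  ... | inj₂ y = proj₁ (decode (n H) (λ i → n (X i)) y) , suc (proj₂ (decode (n H) (λ i → n (X i)) y))

  decodeX-encodeX : ∀ i x → decode (n H) (λ i → n (X i)) (encodeX i x) ≡ (i , x)
  decodeX-encodeX = decode-encode (n H) (λ i → n (X i))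

  fromFin-toFin : ∀ u → fromFin (toFin u) ≡ u
  fromFin-toFin (i , zero)  rewrite splitAt-↑ˡ (n H) i N = refl
  fromFin-toFin (i , suc x) rewrite splitAt-↑ʳ (n H) N (encodeX i x) | decodeX-encodeX i x = refl

  toFin-fromFin : ∀ v → toFin (fromFin v) ≡ v
  toFin-fromFin v with splitAt (n H) v in split
  ... | inj₁ i = splitAt⁻¹-↑ˡ split
  ... | inj₂ y = trans (cong (n H ↑ʳ_) (encode-decode (n H) (λ i → n (X i)) y)) (splitAt⁻¹-↑ʳ split)

  toFin-adjacent : ∀ u v → adj (corona H X) (toFin u) (toFin v) ≡ E u v
  toFin-adjacent (i , zero) (j , zero) rewrite splitAt-↑ˡ (n H) i N | splitAt-↑ˡ (n H) j N = refl
  toFin-adjacent (i , zero) (j , suc y)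
    rewrite splitAt-↑ˡ (n H) i N | splitAt-↑ʳ (n H) N (encodeX j y) | decodeX-encodeX j y with i ≟ j
  ... | yes _ = refl
  ... | no _  = refl
  toFin-adjacent (i , suc x) (j , zero)
    rewrite splitAt-↑ʳ (n H) N (encodeX i x) | splitAt-↑ˡ (n H) j N | decodeX-encodeX i x with j ≟ i
  ... | yes _ = refl
  ... | no _  = refl
  toFin-adjacent (i , suc x) (j , suc y)
    rewrite splitAt-↑ʳ (n H) N (encodeX i x) | splitAt-↑ʳ (n H) N (encodeX j y)
          | decodeX-encodeX i x | decodeX-encodeX j y with i ≟ j
  ... | yes refl = refl
  ... | no _     = refl

  ≅-corona : E ≅ adj (corona H X)
  ≅-corona = record
    { to       = toFin
    ; from     = fromFin
    ; from-to  = fromFin-toFin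
    ; to-from  = toFin-fromFin
    ; adjacent = toFin-adjacent
    }

  at : ∀ i → V → Maybe (Fin (suc (n (X i))))
  at i (j , x) with i ≟ j
  ... | yes refl = just x
  ... | no _     = nothing

  at≡just : ∀ i u {x} → at i u ≡ just x → u ≡ (i , x)
  at≡just i (j , y) eq with i ≟ j
  at≡just i (i , y) refl | yes refl = refl

  at-self : ∀ i x → at i (i , x) ≡ just x
  at-self i x with i ≟ i
  ... | yes refl = refl
  ... | no i≢i   = contradiction refl i≢i

  apex : V → Maybe (Fin (n H))
  apex (i , zero)  = just i
  apex (_ , suc _) = nothing

  apex≡just : ∀ u {i} → apex u ≡ just i → u ≡ (i , zero)
  apex≡just (_ , zero) refl = refl

  restrict-H : PartialEmbedding E (adj H)
  restrict-H = record
    { apply     = apex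
    ; injective = λ { {_ , zero} {_ , zero} refl refl → refl }
    ; adjacent  = λ { {_ , zero} {_ , zero} refl refl → refl }
    }

  include-H : PartialEmbedding (adj H) E
  include-H = embedding (_, zero) (λ { refl → refl }) (λ _ _ → refl)

  module _ (sH : IsSimple H) where

    restrict : ∀ i → PartialEmbedding E (adj (cone (X i)))
    restrict i = record
      { apply     = at i
      ; injective = λ {u} {u′} p q → trans (at≡just i u p) (sym (at≡just i u′ q))
      ; adjacent  = λ {u} {u′} {x} {y} p q → subst₂ (λ w w′ → adj (cone (X i)) x y ≡ E w w′)
                      (sym (at≡just i u p)) (sym (at≡just i u′ q)) (sym (E-within sH i x y))
      }

    include : ∀ i → PartialEmbedding (adj (cone (X i))) E
    include i = embedding (i ,_) (λ { refl → refl }) (E-within sH i)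

    module Independence (sX : ∀ i → IsSimple (X i)) (nonempty : ∀ i → 1 ≤ n (X i))
                        {a : Fin (n H) → ℕ} (α : ∀ i → IsAlpha (X i) (a i)) where

      independent≤Σα : ∀ {T} → Independent E T → length T ≤ total (n H) a
      independent≤Σα {T} indT = begin
        length T
          ≤⟨ length≤cover at {T} (All.tabulate λ { {j , x} _ → j , at-defined j x }) ⟩
        total (n H) (λ i → length (mapMaybe (at i) T))
          ≤⟨ total-mono-≤ (n H) (λ i → Cone.independent≤α (X i) (α i) (fromℕ< (nonempty i)) (proj₂ (sX i) _)
                                          (Image.image-independent (restrict i) indT)) ⟩
        total (n H) a
          ∎
        where
        open ≤-Reasoning
        at-defined : ∀ j x → Is-just (at j (j , x))
        at-defined j x = subst Is-just (sym (at-self j x)) (just tt)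

      maximum-independent : ∃[ S ] Independent E S × length S ≡ total (n H) a
      maximum-independent =
          ⋃ (n H) piece
        , ⋃-independent (n H) piece (λ i → Unique.map⁺ (λ { refl → refl }) (proj₁ (S-independent i)))
                        (λ c∈ c∈′ → trans (sym (piece-index c∈)) (piece-index c∈′)) nonadjacent
        , trans (length-⋃ (n H) piece) (total-cong (n H) λ i → trans (length-map _ (S i)) (|S| i))
        where
        S : ∀ i → List (Fin (n (X i)))
        S i = proj₁ (proj₁ (α i))
        S-independent : ∀ i → Independent (adj (X i)) (S i)
        S-independent i = proj₁ (proj₂ (proj₁ (α i)))
        |S| : ∀ i → length (S i) ≡ a i
        |S| i = proj₂ (proj₂ (proj₁ (α i)))
        piece : ∀ i → List V
        piece i = map (λ x → i , suc x) (S i)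
        piece-index : ∀ {i c} → c ∈ piece i → proj₁ c ≡ i
        piece-index c∈ with ∈-map⁻ _ c∈
        ... | _ , _ , refl = refl
        nonadjacent : ∀ {i j u v} → u ∈ piece i → v ∈ piece j → E u v ≡ false
        nonadjacent {i} {j} u∈ v∈ with ∈-map⁻ _ u∈ | ∈-map⁻ _ v∈
        ... | x , x∈ , refl | y , y∈ , refl with i ≟ j
        ...   | yes refl = proj₂ (S-independent i) x y x∈ y∈
        ...   | no _     = refl

      α-corona : IsMaxSize (Independent E) (total (n H) a)
      α-corona = maximum-independent , λ _ → independent≤Σα

    module Matchings {m mᶜ : Fin (n H) → ℕ} (μ : ∀ i → IsMu (X i) (m i)) (μᶜ : ∀ i → IsMu (cone (X i)) (mᶜ i)) where

      -- vᵢ ∈ F iff mᶜ i ≡ m i; f is the indicator of F and load N counts the F-vertices covered by N.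
      F? : Decidable (λ i → mᶜ i ≡ m i)
      F? i = mᶜ i ℕ.≟ m i

      f : Fin (n H) → ℕ
      f i = 𝟙 (does (F? i))

      S : ℕ
      S = total (n H) mᶜ

      load : List (Fin (n H) × Fin (n H)) → ℕ
      load N = sum (map f (ends N))

      F-Independent : Set
      F-Independent = ∀ u v → mᶜ u ≡ m u → mᶜ v ≡ m v → adj H u v ≡ false

      hub-and-cone⇒loop : ∀ i u v → Is-just (zip (apex u) (apex v)) → Is-just (zip (at i u) (at i v)) → u ≡ v
      hub-and-cone⇒loop i (j , zero)  (j′ , zero) _ cone-edge with i ≟ j | i ≟ j′
      hub-and-cone⇒loop i (j , zero)  (j′ , zero) _ cone-edge | yes refl | yes refl = refl
      hub-and-cone⇒loop i (j , zero)  (j′ , zero) _ ()        | no _     | _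
      hub-and-cone⇒loop i (j , zero)  (j′ , zero) _ ()        | yes refl | no _
      hub-and-cone⇒loop i (j , zero)  (j′ , suc _) () _
      hub-and-cone⇒loop i (j , suc _) v            () _

      module _ {M : List (V × V)} (mM : Matching E M) where

        Mᴴ : List (Fin (n H) × Fin (n H))
        Mᴴ = image² restrict-H M

        Mᶜ : ∀ i → List (Fin (suc (n (X i))) × Fin (suc (n (X i))))
        Mᶜ i = image² (restrict i) M

        Mᴴ-matching : Matching (adj H) Mᴴ
        Mᴴ-matching = Image.image-matching restrict-H mM

        Mᶜ-matching : ∀ i → Matching (adj (cone (X i))) (Mᶜ i)
        Mᶜ-matching i = Image.image-matching (restrict i) mM

        covered : Fin (n H) → ℕ
        covered i = 𝟙 (does (i ∈? ends Mᴴ))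

        length≤cones+hub : length M ≤ total (n H) (λ i → length (Mᶜ i)) + length Mᴴ
        length≤cones+hub = length≤parts (λ i → apply² (restrict i)) (apply² restrict-H)
                             (All.map (λ {e} → classify e) (proj₁ mM))
          where
          classify : ∀ e → E (proj₁ e) (proj₂ e) ≡ true →
                     (∃[ i ] Is-just (apply² (restrict i) e)) ⊎ Is-just (apply² restrict-H e)
          classify (u , v) uv with edge-view u v uv
          ... | within i x y = inj₁ (i , subst Is-just (sym (cong₂ zip (at-self i x) (at-self i y))) (just tt))
          ... | between i j  = inj₂ (just tt)

        hub-covered⇒apex-free : ∀ i → i ∈ ends Mᴴ → zero ∉ ends (Mᶜ i)
        hub-covered⇒apex-free i i∈ zero∈
          with Image.∈-ends-image²⇒edge restrict-H M i∈ | Image.∈-ends-image²⇒edge (restrict i) M zero∈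
        ... | e , e∈ , hub-edge , a , a∈e , apex-a | e′ , e′∈ , cone-edge , a′ , a′∈e′ , at-a′
          with apex≡just a apex-a | at≡just i a′ at-a′
        ... | refl | refl with same-edge (proj₂ mM) e∈ e′∈ a∈e a′∈e′
        ... | refl = ends-unique⇒loopless (proj₂ mM) e∈ (hub-and-cone⇒loop i (proj₁ e) (proj₂ e) hub-edge cone-edge)

        per-cone : ∀ i → length (Mᶜ i) + covered i ≤ mᶜ i + covered i * f i
        per-cone i with i ∈? ends Mᴴ
        ... | yes i∈ = begin
          length (Mᶜ i) + 1  ≤⟨ +-monoˡ-≤ 1 (Cone.apex-free-matching≤μ (X i) (μ i) (Mᶜ-matching i)
                                                                    (hub-covered⇒apex-free i i∈)) ⟩
          m i + 1            ≡⟨ +-comm (m i) 1 ⟩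
          suc (m i)          ≡⟨ sym (Cone.μᶜ+𝟙≡suc-μ (X i) (μ i) (μᶜ i) (F? i)) ⟩
          mᶜ i + f i         ≡⟨ cong (mᶜ i +_) (sym (*-identityˡ (f i))) ⟩
          mᶜ i + 1 * f i     ∎
          where open ≤-Reasoning
        ... | no _   = +-monoˡ-≤ 0 (proj₂ (Equivalence.to (IsMu⇔ (cone (X i))) (μᶜ i)) _ (Mᶜ-matching i))

        -- The apex of a cone Xᵢ covered by Mᴴ costs that cone an edge unless vᵢ ∈ F, as mᶜ i + f i ≡ suc (m i).
        matching-bound : length M + length Mᴴ ≤ S + load Mᴴ
        matching-bound = begin
          length M + length Mᴴ
            ≤⟨ +-monoˡ-≤ (length Mᴴ) length≤cones+hub ⟩
          total (n H) (λ i → length (Mᶜ i)) + length Mᴴ + length Mᴴ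
            ≡⟨ +-assoc _ (length Mᴴ) (length Mᴴ) ⟩
          total (n H) (λ i → length (Mᶜ i)) + (length Mᴴ + length Mᴴ)
            ≡⟨ cong (total (n H) (λ i → length (Mᶜ i)) +_) (trans (sym (length-ends Mᴴ)) (length≡total (proj₂ Mᴴ-matching))) ⟩
          total (n H) (λ i → length (Mᶜ i)) + total (n H) covered
            ≡⟨ sym (total-distrib-+ (n H) _ covered) ⟩
          total (n H) (λ i → length (Mᶜ i) + covered i)
            ≤⟨ total-mono-≤ (n H) per-cone ⟩
          total (n H) (λ i → mᶜ i + covered i * f i)
            ≡⟨ total-distrib-+ (n H) mᶜ _ ⟩
          S + total (n H) (λ i → covered i * f i)
            ≡⟨ cong (S +_) (sym (sum-map≡total f (proj₂ Mᴴ-matching))) ⟩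
          S + load Mᴴ
            ∎
          where open ≤-Reasoning

      load≤count : ∀ {N} → Unique (ends N) → load N ≤ count F?
      load≤count {N} uN = begin
        load N
          ≡⟨ sum-map≡total f uN ⟩
        total (n H) (λ i → 𝟙 (does (i ∈? ends N)) * f i)
          ≤⟨ total-mono-≤ (n H) (λ i → 𝟙*≤ (does (i ∈? ends N)) (f i)) ⟩
        count F?
          ∎
        where
        open ≤-Reasoning
        𝟙*≤ : ∀ b x → 𝟙 b * x ≤ x
        𝟙*≤ true  x = ≤-reflexive (*-identityˡ x)
        𝟙*≤ false x = z≤n

      load≤2|N| : ∀ N → load N ≤ length N + length N
      load≤2|N| N = ≤-trans (sum-map-f≤length (ends N)) (≤-reflexive (length-ends N))
        where
        sum-map-f≤length : ∀ L → sum (map f L) ≤ length L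
        sum-map-f≤length []      = z≤n
        sum-map-f≤length (i ∷ L) = +-mono-≤ (𝟙≤1 (does (F? i))) (sum-map-f≤length L)

      load≤|N| : (∀ u v → adj H u v ≡ true → f u + f v ≤ 1) →
                 ∀ {N} → All (λ e → adj H (proj₁ e) (proj₂ e) ≡ true) N → load N ≤ length N
      load≤|N| sparse []                         = z≤n
      load≤|N| sparse {(u , v) ∷ N} (uv ∷ edges) =
        ≤-trans (≤-reflexive (sym (+-assoc (f u) (f v) (load N)))) (+-mono-≤ (sparse u v uv) (load≤|N| sparse edges))

      matching≤ : ∀ {M} → Matching E M → length M + length M ≤ S + S + count F?
      matching≤ {M} mM = +-cancelʳ-≤ (h + h) (length M + length M) (S + S + count F?) (begin
        length M + length M + (h + h)     ≡⟨ interchange (length M) (length M) h h ⟩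
        (length M + h) + (length M + h)   ≤⟨ +-mono-≤ (matching-bound mM) (matching-bound mM) ⟩
        (S + e) + (S + e)                 ≡⟨ interchange S e S e ⟩
        S + S + (e + e)                   ≤⟨ +-monoʳ-≤ (S + S) (+-mono-≤ (load≤count (proj₂ (Mᴴ-matching mM)))
                                                                          (load≤2|N| (Mᴴ mM))) ⟩
        S + S + (count F? + (h + h))      ≡⟨ sym (+-assoc (S + S) (count F?) (h + h)) ⟩
        S + S + count F? + (h + h)        ∎)
        where
        open ≤-Reasoning
        h e : ℕ
        h = length (Mᴴ mM)
        e = load (Mᴴ mM)

      F-independent⇒matching≤S : F-Independent → ∀ {M} → Matching E M → length M ≤ S
      F-independent⇒matching≤S independent {M} mM =
        +-cancelʳ-≤ (length (Mᴴ mM)) (length M) S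
          (≤-trans (matching-bound mM) (+-monoʳ-≤ S (load≤|N| sparse (proj₁ (Mᴴ-matching mM)))))
        where
        sparse : ∀ u v → adj H u v ≡ true → f u + f v ≤ 1
        sparse u v uv = at-most-one (F? u) (F? v)
          where
          at-most-one : (u∈F? : Dec (mᶜ u ≡ m u)) (v∈F? : Dec (mᶜ v ≡ m v)) → 𝟙 (does u∈F?) + 𝟙 (does v∈F?) ≤ 1
          at-most-one (yes u∈F) (yes v∈F) = contradiction (trans (sym (independent u v u∈F v∈F)) uv) λ ()
          at-most-one (yes _)   (no _)    = s≤s z≤n
          at-most-one (no _)    v∈F?      = 𝟙≤1 (does v∈F?)

      ApexAvoidingMaxima : Set
      ApexAvoidingMaxima = ∀ i → ∃[ M ] Matching (adj (cone (X i))) M × length M ≡ mᶜ i × (mᶜ i ≡ m i → zero ∉ ends M)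

      -- C is a parameter so that the type checker never unfolds the chosen matchings (which exhausts memory).
      module HubUnion (C : ApexAvoidingMaxima) {N : List (Fin (n H) × Fin (n H))} where

        piece : ∀ i → List (V × V)
        piece i = image² (include i) (proj₁ (C i))

        piece-length : ∀ i → length (piece i) ≡ mᶜ i
        piece-length i = trans (Image.length-image² (include i) (λ _ → just tt) (proj₁ (C i))) (proj₁ (proj₂ (proj₂ (C i))))

        ∈-piece : ∀ {i w} → w ∈ ends (piece i) → ∃[ x ] x ∈ ends (proj₁ (C i)) × w ≡ (i , x)
        ∈-piece {i} w∈ with Image.∈-ends-image²⁻ (include i) (proj₁ (C i)) w∈
        ... | x , x∈ , refl = x , x∈ , refl

        pieces-matching : Matching E (⋃ (n H) piece)
        pieces-matching = ⋃-matching (n H) piece (λ i → Image.image-matching (include i) (proj₁ (proj₂ (C i)))) disjoint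
          where
          disjoint : ∀ {i j w} → w ∈ ends (piece i) → w ∈ ends (piece j) → i ≡ j
          disjoint w∈ w∈′ with ∈-piece w∈ | ∈-piece w∈′
          ... | _ , _ , refl | _ , _ , refl = refl

        hub-disjoint : (∀ {u} → u ∈ ends N → mᶜ u ≡ m u) →
                       ∀ {w} → ¬ (w ∈ ends (image² include-H N) × w ∈ ends (⋃ (n H) piece))
        hub-disjoint inF (w∈ᴴ , w∈) with Image.∈-ends-image²⁻ include-H N w∈ᴴ | ∈-ends⁻ (⋃ (n H) piece) w∈
        ... | u , u∈ , refl | e , e∈ , w∈e with ∈-⋃⁻ (n H) piece e∈
        ... | j , e∈ⱼ with ∈-piece (∈-ends⁺ e∈ⱼ w∈e)
        ... | x , x∈ , refl = proj₂ (proj₂ (proj₂ (C u))) (inF u∈) x∈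

        hub-union : Matching (adj H) N → (∀ {u} → u ∈ ends N → mᶜ u ≡ m u) →
                    ∃[ M ] Matching E M × length M ≡ S + length N
        hub-union mN inF =
            image² include-H N ++ ⋃ (n H) piece
          , ++-matching (Image.image-matching include-H mN) pieces-matching (hub-disjoint inF)
          , (begin
              length (image² include-H N ++ ⋃ (n H) piece)
                ≡⟨ length-++ (image² include-H N) ⟩
              length (image² include-H N) + length (⋃ (n H) piece)
                ≡⟨ cong₂ _+_ (Image.length-image² include-H (λ _ → just tt) N)
                             (trans (length-⋃ (n H) piece) (total-cong (n H) piece-length)) ⟩
              length N + S
                ≡⟨ +-comm (length N) S ⟩
              S + length N
                ∎)
          where open ≡-Reasoning

      matching-through-hub : ∀ {N} → Matching (adj H) N → (∀ {u} → u ∈ ends N → mᶜ u ≡ m u) →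
                             ∃[ M ] Matching E M × length M ≡ S + length N
      matching-through-hub = HubUnion.hub-union (λ i → Cone.apex-avoiding-maximum (X i) (μ i) (μᶜ i))

-- König–Egerváry defects and the characterisation

-- The truncated subtraction in defect is exact, by n≡α+μ+defect.
module Defect (Y : Graph) {a m : ℕ} (α : IsAlpha Y a) (μ : IsMu Y m) where

  defect : ℕ
  defect = n Y ∸ (a + m)

  α+μ≤n : a + m ≤ n Y
  α+μ≤n = let S , indS , |S| = proj₁ α ; M , mM , |M| = proj₁ μ in
    subst₂ (λ x y → x + y ≤ n Y) |S| |M| (independent+matching≤ indS (Equivalence.to (IsMatching⇔Matching Y M) mM))

  n≡α+μ+defect : n Y ≡ a + m + defect
  n≡α+μ+defect = sym (m+[n∸m]≡n α+μ≤n)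

  private
    values : ∀ {a′ m′} → IsAlpha Y a′ → IsMu Y m′ → a′ + m′ ≡ a + m
    values α′ μ′ = cong₂ _+_ (IsMaxSize-unique α′ α) (IsMaxSize-unique μ′ μ)

  IsKE⇔defect≡0 : IsKE Y ⇔ defect ≡ 0
  IsKE⇔defect≡0 = mk⇔
    (λ (_ , _ , α′ , μ′ , eq) → +-cancelˡ-≡ (a + m) defect 0
       (trans (sym n≡α+μ+defect) (trans (sym eq) (trans (values α′ μ′) (sym (+-identityʳ (a + m)))))))
    (λ defect≡0 → a , m , α , μ , trans (sym (+-identityʳ (a + m))) (trans (cong (a + m +_) (sym defect≡0)) (sym n≡α+μ+defect)))

  Is1KE⇔defect≡1 : Is1KE Y ⇔ defect ≡ 1
  Is1KE⇔defect≡1 = mk⇔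
    (λ (_ , _ , α′ , μ′ , eq) → +-cancelˡ-≡ (a + m) defect 1
       (trans (sym n≡α+μ+defect) (trans (sym eq) (trans (cong suc (values α′ μ′)) (+-comm 1 (a + m))))))
    (λ defect≡1 → a , m , α , μ , trans (+-comm 1 (a + m)) (trans (cong (a + m +_) (sym defect≡1)) (sym n≡α+μ+defect)))

halve-≤ : ∀ {m n} → m + m ≤ n + n → m ≤ n
halve-≤ {m} {n} m+m≤n+n with m ≤? n
... | yes m≤n = m≤n
... | no m≰n  = contradiction m+m≤n+n (<⇒≱ (+-mono-< (≰⇒> m≰n) (≰⇒> m≰n)))

-- Used with t = μ(G) − S, φ = |F| and δ as in the header.
excess-cases : ∀ t φ δ → t + t ≤ φ → suc t ≡ φ + δ →
               (φ ≡ 0 × δ ≡ 1) ⊎ (φ ≡ 1 × δ ≡ 0) ⊎ (φ ≡ 2 × δ ≡ 0 × t ≡ 1)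
excess-cases 0             0                   δ _        refl = inj₁ (refl , refl)
excess-cases 0             1                   δ _        refl = inj₂ (inj₁ (refl , refl))
excess-cases 0             (suc (suc _))       δ _        ()
excess-cases 1             0                   δ ()       _
excess-cases 1             1                   δ (s≤s ()) _
excess-cases 1             2                   δ _        refl = inj₂ (inj₂ (refl , refl , refl))
excess-cases 1             (suc (suc (suc _))) δ _        ()
excess-cases (suc (suc t)) φ                   δ 2t≤φ     eq   =
  contradiction (≤-trans 2t≤φ φ≤) (<⇒≱ (s≤s (s≤s (m≤n+m (suc (suc t)) t))))
  where
  φ≤ : φ ≤ suc (suc (suc t))
  φ≤ = subst (φ ≤_) (sym eq) (m≤m+n φ δ)

-- a, m and mᶜ are parameters rather than α-exists and μ-exists, for the same reason as C in HubUnion.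
module Analysis (H : Graph) (X : Fin (n H) → Graph) (sH : IsSimple H) (sX : ∀ i → IsSimple (X i))
                (nonempty : ∀ i → 1 ≤ n (X i)) {a m mᶜ : Fin (n H) → ℕ} (α : ∀ i → IsAlpha (X i) (a i))
                (μ : ∀ i → IsMu (X i) (m i)) (μᶜ : ∀ i → IsMu (cone (X i)) (mᶜ i)) where

  open Corona H X
  open Independence sH sX nonempty α
  open Matchings sH μ μᶜ

  d : Fin (n H) → ℕ
  d i = Defect.defect (X i) (α i) (μ i)

  φ δ : ℕ
  φ = count F?
  δ = total (n H) d

  InF⇔ : ∀ {i} → InF H X i ⇔ (mᶜ i ≡ m i)
  InF⇔ {i} = mk⇔ (λ (_ , μ′ , μᶜ′) → trans (IsMaxSize-unique (μᶜ i) μᶜ′) (IsMaxSize-unique μ′ (μ i)))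
                 (λ mᶜ≡m → m i , μ i , subst (IsMu (cone (X i))) mᶜ≡m (μᶜ i))

  A : ℕ
  A = total (n H) a

  vertex-count : n (corona H X) ≡ A + (S + φ + δ)
  vertex-count = begin
    n H + total (n H) (λ i → n (X i))                     ≡⟨ total-suc (n H) (λ i → n (X i)) ⟨
    total (n H) (λ i → suc (n (X i)))                     ≡⟨ total-cong (n H) cone-count ⟩
    total (n H) (λ i → a i + mᶜ i + f i + d i)            ≡⟨ total-distrib-+ (n H) _ d ⟩
    total (n H) (λ i → a i + mᶜ i + f i) + δ              ≡⟨ cong (_+ δ) (total-distrib-+ (n H) _ f) ⟩
    total (n H) (λ i → a i + mᶜ i) + φ + δ                ≡⟨ cong (λ x → x + φ + δ) (total-distrib-+ (n H) a mᶜ) ⟩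
    A + S + φ + δ                                         ≡⟨ cong (_+ δ) (+-assoc A S φ) ⟩
    A + (S + φ) + δ                                       ≡⟨ +-assoc A (S + φ) δ ⟩
    A + (S + φ + δ)                                       ∎
    where
    open ≡-Reasoning
    cone-count : ∀ i → suc (n (X i)) ≡ a i + mᶜ i + f i + d i
    cone-count i = begin
      suc (n (X i))                 ≡⟨ cong suc (Defect.n≡α+μ+defect (X i) (α i) (μ i)) ⟩
      suc (a i + m i) + d i         ≡⟨ cong (_+ d i) (+-suc (a i) (m i)) ⟨
      a i + suc (m i) + d i         ≡⟨ cong (λ x → a i + x + d i) (Cone.μᶜ+𝟙≡suc-μ (X i) (μ i) (μᶜ i) (F? i)) ⟨
      a i + (mᶜ i + f i) + d i      ≡⟨ cong (_+ d i) (+-assoc (a i) (mᶜ i) (f i)) ⟨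
      a i + mᶜ i + f i + d i        ∎

  α-corona-G : IsAlpha (corona H X) A
  α-corona-G = ≅-α ≅-corona α-corona

  IsMu⇒maximum : ∀ {μ′} → IsMu (corona H X) μ′ → IsMaxSize (Matching E) μ′
  IsMu⇒maximum μᴳ = ≅-μ (≅-sym ≅-corona) (Equivalence.to (IsMu⇔ (corona H X)) μᴳ)

  Is1KE⇒μ-equation : Is1KE (corona H X) → ∃[ μ′ ] IsMaxSize (Matching E) μ′ × suc μ′ ≡ S + φ + δ
  Is1KE⇒μ-equation (a′ , μ′ , α′ , μᴳ , eq) = μ′ , IsMu⇒maximum μᴳ ,
    +-cancelˡ-≡ A (suc μ′) (S + φ + δ) (begin
      A + suc μ′            ≡⟨ +-suc A μ′ ⟩
      suc (A + μ′)          ≡⟨ cong (λ x → suc (x + μ′)) (IsMaxSize-unique α-corona-G α′) ⟩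
      suc (a′ + μ′)         ≡⟨ eq ⟩
      n (corona H X)        ≡⟨ vertex-count ⟩
      A + (S + φ + δ)       ∎)
    where open ≡-Reasoning

  μ-equation⇒Is1KE : ∀ {μ′} → IsMaxSize (Matching E) μ′ → suc μ′ ≡ S + φ + δ → Is1KE (corona H X)
  μ-equation⇒Is1KE {μ′} max eq =
    A , μ′ , α-corona-G , Equivalence.from (IsMu⇔ (corona H X)) (≅-μ ≅-corona max) , (begin
      suc (A + μ′)         ≡⟨ +-suc A μ′ ⟨
      A + suc μ′           ≡⟨ cong (A +_) eq ⟩
      A + (S + φ + δ)      ≡⟨ vertex-count ⟨
      n (corona H X)       ∎)
    where open ≡-Reasoning

  module Maximum {μ′ : ℕ} (max : IsMaxSize (Matching E) μ′) where

    S≤μ : S ≤ μ′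
    S≤μ = let M , mM , |M| = matching-through-hub {[]} ([] , []) λ () in
      subst (_≤ μ′) (trans |M| (+-identityʳ S)) (proj₂ max M mM)

    μ+μ≤S+S+φ : μ′ + μ′ ≤ S + S + φ
    μ+μ≤S+S+φ = let M , mM , |M| = proj₁ max in subst (λ x → x + x ≤ S + S + φ) |M| (matching≤ mM)

    F-independent⇒μ≤S : F-Independent → μ′ ≤ S
    F-independent⇒μ≤S independent = let M , mM , |M| = proj₁ max in
      subst (_≤ S) |M| (F-independent⇒matching≤S independent mM)

    F-edge⇒S<μ : ∀ {j j′} → j ≢ j′ → adj H j j′ ≡ true → mᶜ j ≡ m j → mᶜ j′ ≡ m j′ → suc S ≤ μ′
    F-edge⇒S<μ {j} {j′} j≢j′ jj′ j∈F j′∈F =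
      let M , mM , |M| = matching-through-hub {(j , j′) ∷ []} (jj′ ∷ [] , (j≢j′ ∷ []) ∷ [] ∷ []) in-F
      in  subst (_≤ μ′) (trans |M| (+-comm S 1)) (proj₂ max M mM)
      where
      in-F : ∀ {u} → u ∈ j ∷ j′ ∷ [] → mᶜ u ≡ m u
      in-F (here refl)         = j∈F
      in-F (there (here refl)) = j′∈F

  open Maximum

  F-enumeration : ∃[ L ] Unique L × (∀ {i} → InF H X i → i ∈ L) × (∀ {i} → i ∈ L → InF H X i) × φ ≡ length L
  F-enumeration = let L , uL , F⇒∈ , ∈⇒F = enumerate F? in
    L , uL , (λ i∈F → F⇒∈ (Equivalence.to InF⇔ i∈F)) , (λ i∈ → Equivalence.from InF⇔ (∈⇒F i∈))
      , count≡length F? uL F⇒∈ ∈⇒F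

  φ≡length : ∀ {L} → Unique L → (∀ {i} → InF H X i → i ∈ L) → (∀ {i} → i ∈ L → InF H X i) → φ ≡ length L
  φ≡length uL F⇒∈ ∈⇒F =
    count≡length F? uL (λ i∈F → F⇒∈ (Equivalence.from InF⇔ i∈F)) (λ i∈ → Equivalence.to InF⇔ (∈⇒F i∈))

  φ≡0⇒K0 : φ ≡ 0 → InducedK0 H (InF H X)
  φ≡0⇒K0 φ≡0 with F-enumeration
  ... | []    , _ , F⇒∈ , _ , _  = λ v v∈F → contradiction (F⇒∈ v∈F) λ ()
  ... | _ ∷ _ , _ , _   , _ , φ≡ = contradiction (trans (sym φ≡0) φ≡) λ ()

  φ≡1⇒K1 : φ ≡ 1 → InducedK1 H (InF H X)
  φ≡1⇒K1 φ≡1 with F-enumeration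
  ... | j ∷ []    , _ , F⇒∈ , ∈⇒F , _  = j , ∈⇒F (here refl) , λ w w∈F → only (F⇒∈ w∈F)
    where
    only : ∀ {w} → w ∈ j ∷ [] → w ≡ j
    only (here w≡j) = w≡j
  ... | []        , _ , _ , _ , φ≡ = contradiction (trans (sym φ≡1) φ≡) λ ()
  ... | _ ∷ _ ∷ _ , _ , _ , _ , φ≡ = contradiction (trans (sym φ≡1) φ≡) λ ()

  φ≡2⇒F-pair : φ ≡ 2 →
               ∃[ j ] ∃[ j′ ] (j ≢ j′ × InF H X j × InF H X j′ × (∀ u → InF H X u → u ≡ j ⊎ u ≡ j′))
  φ≡2⇒F-pair φ≡2 with F-enumeration
  ... | j ∷ j′ ∷ [] , (j∉ ∷ _) , F⇒∈ , ∈⇒F , _ =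
    j , j′ , All.head j∉ , ∈⇒F (here refl) , ∈⇒F (there (here refl)) , λ u u∈F → only (F⇒∈ u∈F)
    where
    only : ∀ {u} → u ∈ j ∷ j′ ∷ [] → u ≡ j ⊎ u ≡ j′
    only (here u≡j)         = inj₁ u≡j
    only (there (here u≡j′)) = inj₂ u≡j′
  ... | []            , _ , _ , _ , φ≡ = contradiction (trans (sym φ≡2) φ≡) λ ()
  ... | _ ∷ []        , _ , _ , _ , φ≡ = contradiction (trans (sym φ≡2) φ≡) λ ()
  ... | _ ∷ _ ∷ _ ∷ _ , _ , _ , _ , φ≡ = contradiction (trans (sym φ≡2) φ≡) λ ()

  K0⇒φ≡0 : InducedK0 H (InF H X) → φ ≡ 0
  K0⇒φ≡0 none = φ≡length [] (λ {v} v∈F → contradiction v∈F (none v)) λ ()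

  K1⇒φ≡1 : InducedK1 H (InF H X) → φ ≡ 1
  K1⇒φ≡1 (j , j∈F , only) = φ≡length ([] ∷ []) (λ {u} u∈F → here (only u u∈F)) λ { (here refl) → j∈F }

  K2⇒φ≡2 : InducedK2 H (InF H X) → φ ≡ 2
  K2⇒φ≡2 (j , j′ , j≢j′ , _ , j∈F , j′∈F , only) =
    φ≡length ((j≢j′ ∷ []) ∷ [] ∷ []) (λ {u} u∈F → pair (only u u∈F))
      λ { (here refl) → j∈F ; (there (here refl)) → j′∈F }
    where
    pair : ∀ {u} → u ≡ j ⊎ u ≡ j′ → u ∈ j ∷ j′ ∷ []
    pair (inj₁ u≡j)  = here u≡j
    pair (inj₂ u≡j′) = there (here u≡j′)

  nonadjacent-pair⇒F-independent : ∀ j j′ → adj H j j′ ≡ false → (∀ u → InF H X u → u ≡ j ⊎ u ≡ j′) → F-Independent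
  nonadjacent-pair⇒F-independent j j′ jj′ only u v u∈F v∈F
    with only u (Equivalence.from InF⇔ u∈F) | only v (Equivalence.from InF⇔ v∈F)
  ... | inj₁ refl | inj₁ refl = proj₂ sH j
  ... | inj₁ refl | inj₂ refl = jj′
  ... | inj₂ refl | inj₁ refl = trans (proj₁ sH j′ j) jj′
  ... | inj₂ refl | inj₂ refl = proj₂ sH j′

  IsKE⇔ : ∀ i → IsKE (X i) ⇔ d i ≡ 0
  IsKE⇔ i = Defect.IsKE⇔defect≡0 (X i) (α i) (μ i)

  Is1KE⇔ : ∀ i → Is1KE (X i) ⇔ d i ≡ 1
  Is1KE⇔ i = Defect.Is1KE⇔defect≡1 (X i) (α i) (μ i)

  δ≡0⇒KE : δ ≡ 0 → ∀ i → IsKE (X i)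
  δ≡0⇒KE δ≡0 i = Equivalence.from (IsKE⇔ i) (total≡0⇒term≡0 (n H) d δ≡0 i)

  KE⇒δ≡0 : (∀ i → IsKE (X i)) → δ ≡ 0
  KE⇒δ≡0 KE = total-zero (n H) λ i → Equivalence.to (IsKE⇔ i) (KE i)

  δ≡1⇒one-1KE : δ ≡ 1 → ∃[ j ] (Is1KE (X j) × (∀ i → i ≢ j → IsKE (X i)))
  δ≡1⇒one-1KE δ≡1 = let j , dj≡1 , others = total≡1⇒concentrated (n H) d δ≡1 in
    j , Equivalence.from (Is1KE⇔ j) dj≡1 , λ i i≢j → Equivalence.from (IsKE⇔ i) (others i i≢j)

  one-1KE⇒δ≡1 : ∀ {j} → Is1KE (X j) → (∀ i → i ≢ j → IsKE (X i)) → δ ≡ 1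
  one-1KE⇒δ≡1 {j} 1KE KE =
    trans (total-concentrated (n H) d j λ i i≢j → Equivalence.to (IsKE⇔ i) (KE i i≢j)) (Equivalence.to (Is1KE⇔ j) 1KE)

  Conditions : Set
  Conditions = (InducedK0 H (InF H X) × ∃[ j ] (Is1KE (X j) × (∀ i → i ≢ j → IsKE (X i))))
             ⊎ (InducedK1 H (InF H X) × (∀ i → IsKE (X i)))
             ⊎ (InducedK2 H (InF H X) × (∀ i → IsKE (X i)))

  Is1KE⇒excess : Is1KE (corona H X) → ∃[ t ] IsMaxSize (Matching E) (S + t) × t + t ≤ φ × suc t ≡ φ + δ
  Is1KE⇒excess 1KE with Is1KE⇒μ-equation 1KE
  ... | μ′ , max , eq with μ′ ∸ S | m+[n∸m]≡n (S≤μ max)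
  ... | t | refl = t , max
                 , +-cancelˡ-≤ (S + S) (t + t) φ (subst (_≤ S + S + φ) (interchange S t S t) (μ+μ≤S+S+φ max))
                 , +-cancelˡ-≡ S (suc t) (φ + δ) (trans (+-suc S t) (trans eq (+-assoc S φ δ)))

  excess⇒μ-equation : ∀ {μ′ t} → μ′ ≡ S + t → suc t ≡ φ + δ → suc μ′ ≡ S + φ + δ
  excess⇒μ-equation {t = t} refl eq = trans (sym (+-suc S t)) (trans (cong (S +_) eq) (sym (+-assoc S φ δ)))

  F-pair-adjacent : IsMaxSize (Matching E) (S + 1) → ∀ j j′ → (∀ u → InF H X u → u ≡ j ⊎ u ≡ j′) → adj H j j′ ≡ true
  F-pair-adjacent max j j′ only with adj H j j′ in jj′
  ... | true  = refl
  ... | false = contradiction (F-independent⇒μ≤S max (nonadjacent-pair⇒F-independent j j′ jj′ only)) λ S+1≤S →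
                  1+n≰n (subst (_≤ S) (+-comm S 1) S+1≤S)

  Is1KE⇒Conditions : Is1KE (corona H X) → Conditions
  Is1KE⇒Conditions 1KE with Is1KE⇒excess 1KE
  ... | t , max , t+t≤φ , eq with excess-cases t φ δ t+t≤φ eq
  ... | inj₁ (φ≡0 , δ≡1)                = inj₁ (φ≡0⇒K0 φ≡0 , δ≡1⇒one-1KE δ≡1)
  ... | inj₂ (inj₁ (φ≡1 , δ≡0))         = inj₂ (inj₁ (φ≡1⇒K1 φ≡1 , δ≡0⇒KE δ≡0))
  ... | inj₂ (inj₂ (φ≡2 , δ≡0 , refl)) =
    let j , j′ , j≢j′ , j∈F , j′∈F , only = φ≡2⇒F-pair φ≡2 in
    inj₂ (inj₂ ((j , j′ , j≢j′ , F-pair-adjacent max j j′ only , j∈F , j′∈F , only) , δ≡0⇒KE δ≡0))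

  module _ {μ′ : ℕ} (max : IsMaxSize (Matching E) μ′) where

    K0⇒μ≡S : InducedK0 H (InF H X) → μ′ ≡ S
    K0⇒μ≡S none = ≤-antisym (F-independent⇒μ≤S max λ u _ u∈F _ → contradiction (Equivalence.from InF⇔ u∈F) (none u))
                            (S≤μ max)

    K1⇒μ≡S : InducedK1 H (InF H X) → μ′ ≡ S
    K1⇒μ≡S (j , _ , only) =
      ≤-antisym (F-independent⇒μ≤S max (nonadjacent-pair⇒F-independent j j (proj₂ sH j) λ u u∈F → inj₁ (only u u∈F)))
                (S≤μ max)

    K2⇒μ≡1+S : InducedK2 H (InF H X) → μ′ ≡ suc S
    K2⇒μ≡1+S K2@(j , j′ , j≢j′ , jj′ , j∈F , j′∈F , _) =
      ≤-antisym (halve-≤ μ+μ≤1+S+1+S) (F-edge⇒S<μ max j≢j′ jj′ (Equivalence.to InF⇔ j∈F) (Equivalence.to InF⇔ j′∈F))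
      where
      μ+μ≤1+S+1+S : μ′ + μ′ ≤ suc S + suc S
      μ+μ≤1+S+1+S = subst (μ′ + μ′ ≤_)
                      (trans (cong (S + S +_) (K2⇒φ≡2 K2)) (trans (+-comm (S + S) 2) (cong suc (sym (+-suc S S)))))
                          (μ+μ≤S+S+φ max)

    Conditions⇒μ-equation : Conditions → suc μ′ ≡ S + φ + δ
    Conditions⇒μ-equation (inj₁ (K0 , _ , 1KE , KE)) =
      excess⇒μ-equation (trans (K0⇒μ≡S K0) (sym (+-identityʳ S))) (sym (cong₂ _+_ (K0⇒φ≡0 K0) (one-1KE⇒δ≡1 1KE KE)))
    Conditions⇒μ-equation (inj₂ (inj₁ (K1 , KE))) =
      excess⇒μ-equation (trans (K1⇒μ≡S K1) (sym (+-identityʳ S))) (sym (cong₂ _+_ (K1⇒φ≡1 K1) (KE⇒δ≡0 KE)))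
    Conditions⇒μ-equation (inj₂ (inj₂ (K2 , KE))) =
      excess⇒μ-equation (trans (K2⇒μ≡1+S K2) (+-comm 1 S)) (sym (cong₂ _+_ (K2⇒φ≡2 K2) (KE⇒δ≡0 KE)))

  Conditions⇒Is1KE : ∀ {μ′} → IsMu (corona H X) μ′ → Conditions → Is1KE (corona H X)
  Conditions⇒Is1KE μᴳ conditions =
    μ-equation⇒Is1KE (IsMu⇒maximum μᴳ) (Conditions⇒μ-equation (IsMu⇒maximum μᴳ) conditions)

theorem2p10 : (H : Graph) → (X : Fin (n H) → Graph) → IsSimple H → (∀ i → IsSimple (X i))
    → (∀ i → 1 ≤ n (X i))
    → Is1KE (corona H X) ⇔
      ((InducedK0 H (InF H X) × ∃[ j ] (Is1KE (X j) × (∀ i → i ≢ j → IsKE (X i))))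
       ⊎ (InducedK1 H (InF H X) × (∀ i → IsKE (X i)))
       ⊎ (InducedK2 H (InF H X) × (∀ i → IsKE (X i))))
theorem2p10 H X simpleH simpleX nonempty =
  mk⇔ Is1KE⇒Conditions (Conditions⇒Is1KE (proj₂ (μ-exists (corona H X))))
  where
  open Analysis H X simpleH simpleX nonempty (λ i → proj₂ (α-exists (X i)))
                (λ i → proj₂ (μ-exists (X i))) (λ i → proj₂ (μ-exists (cone (X i))))
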